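{- Let $\mathcal M=(Q,s_{in},s_T,s_F,\delta)$ be a deterministic binary Turing machine with input. Then there exists a term $\mathtt{trans}$ of $\Lambda_{\tt det}$ such that, for every term $k$ and every configuration $C$ of $\mathcal M$ with input string $i$: (i) (single steps) if $C$ is final then $\mathtt{trans}\,k\,\lceil C\rceil \rightarrow_{det}^{O(|i|\log|i|)} k\,\lceil C\rceil$, and if $C\to_{\mathcal M} D$ then $\mathtt{trans}\,k\,\lceil C\rceil \rightarrow_{det}^{O(|i|\log|i|)} \mathtt{trans}\,k\,\lceil D\rceil$; (ii) (finite computation) if $D$ is a final configuration reachable from $C$ in $n$ transition steps, then $\mathtt{trans}\,k\,\lceil C\rceil \rightarrow_{det}^{O((n+1)|i|\log|i|)} k\,\lceil D\rceil$; (iii) (diverging computation) if no final configuration is reachable from $C$, then $\mathtt{trans}\,k\,\lceil C\rceil$ diverges (has an infinite $\rightarrow_{det}$ reduction sequence).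
   Context: $\Lambda_{\tt det}$: terms $t ::= v \mid t\,v$, values $v ::= \lambda x.t \mid x$; evaluation contexts $E ::= [\cdot] \mid E\,v$; reduction $E[(\lambda x.t)u] \rightarrow_{det} E[t\{x:=u\}]$. Alphabets: $\mathbb{B}_I=\{0,1,\mathsf{L},\mathsf{R}\}$ (input, $\mathsf{L},\mathsf{R}$ delimiters) and $\mathbb{B}_W=\{0,1,\Box\}$ (work tape, $\Box$ blank). A deterministic binary Turing machine with input is $(Q,s_{in},s_T,s_F,\delta)$: finite state set $Q$, initial state $s_{in}$, final states $s_T,s_F$, partial transition function $\delta:\mathbb{B}_I\times\mathbb{B}_W\times Q\rightharpoonup\{ -1,+1,0\}\times\mathbb{B}_W\times\{\leftarrow,\rightarrow,\downarrow\}\times Q$, defined only on non-final states. A configuration is $(i, n \mid w_l, a, w_r \mid s)$ with $i=\mathsf{L}\cdot u\cdot\mathsf{R}$, $u\in\{0,1\}^*$, the immutable input string, $n\in\mathbb{N}$ the input head position (position $n$ is the $(n+1)$-th character $i_n$ of $i$), $w_l,w_r\in\mathbb{B}_W^*$ the work tape to the left/right of the work head, $a\in\mathbb{B}_W$ the scanned work symbol, $s\in Q$ the state; it is final if $s\in\{s_T,s_F\}$ and then cannot evolve. If $\delta(i_n,a,s)=(d\mid a',m\mid s')$ then $(i,n\mid w_l,a,w_r\mid s)\to_{\mathcal M}(i,n+d\mid w_l',a'',w_r'\mid s')$ where: for $m=\downarrow$, $(w_l',a'',w_r')=(w_l,a',w_r)$; for $m=\leftarrow$, if $w_l=w\,b$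 then $(w,b,a'w_r)$ and if $w_l=\varepsilon$ then $(\varepsilon,\Box,a'w_r)$; for $m=\rightarrow$, if $w_r=b\,w$ then $(w_l a',b,w)$ and if $w_r=\varepsilon$ then $(w_la',\Box,\varepsilon)$. It is assumed the machine never moves the input head beyond the boundaries of the input. Encodings: for a finite ordered alphabet $\Sigma=\{a_1,\dots,a_m\}$, $\lceil a_j\rceil := \lambda x_1.\ldots\lambda x_m.x_j$, strings Scott-encoded as $\lceil\varepsilon\rceil:=\lambda x_1.\ldots\lambda x_m.\lambda x_\varepsilon.x_\varepsilon$, $\lceil a_j r\rceil := \lambda x_1.\ldots\lambda x_m.\lambda x_\varepsilon.x_j\lceil r\rceil$ (orders $0<1<\mathsf{L}<\mathsf{R}$, $0<1<\Box$, a fixed order on $Q$). $\mathrm{bin}(n)$ is the reversed binary representation of $n$ without trailing zeros ($\mathrm{bin}(0)=\varepsilon$, $\mathrm{bin}(2)=01$), Scott-encoded over $\{0,1\}$. Configurations are encoded as $\lceil (i,n\mid w_l,a,w_r\mid s)\rceil := \lambda x.\,x\,\lceil i\rceil\,\lceil \mathrm{bin}(n)\rceil\,\lceil w_l^{R}\rceil\,\lceil a\rceil\,\lceil w_r\rceil\,\lceil s\rceil$, with $w_l^R$ the reversal of $w_l$. -}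

module Defs where

open import Data.Nat using (ℕ; zero; suc; _+_; _*_; _≤_; _<_)
open import Data.Nat.Logarithm using (⌊log₂_⌋)
open import Data.Fin using (Fin; zero; suc; opposite; _↑ˡ_; fromℕ<)
open import Data.List using (List; []; _∷_; _++_; [_]; map; length; reverse; lookup)
open import Data.Maybe using (Maybe; just; nothing)
open import Data.Product using (Σ; _×_; _,_; ∃)
open import Data.Sum using (_⊎_)
open import Relation.Binary.PropositionalEquality using (_≡_; _≢_)

-- The calculus Λ_det  (well-scoped de Bruijn syntax; n = number of free variables)
--   terms  t ::= v | t v        values v ::= λx.t | x

mutual
  data Tm (n : ℕ) : Set where
    val : Val n → Tm n
    app : Tm n → Val n → Tm n

  data Val (n : ℕ) : Set where
    var : Fin n → Val n
    lam : Tm (suc n) → Val n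

ext : ∀ {n m} → (Fin n → Fin m) → Fin (suc n) → Fin (suc m)
ext ρ zero    = zero
ext ρ (suc i) = suc (ρ i)

mutual
  renT : ∀ {n m} → (Fin n → Fin m) → Tm n → Tm m
  renT ρ (val v)   = val (renV ρ v)
  renT ρ (app t v) = app (renT ρ t) (renV ρ v)

  renV : ∀ {n m} → (Fin n → Fin m) → Val n → Val m
  renV ρ (var i) = var (ρ i)
  renV ρ (lam t) = lam (renT (ext ρ) t)

exts : ∀ {n m} → (Fin n → Val m) → Fin (suc n) → Val (suc m)
exts σ zero    = var zero
exts σ (suc i) = renV suc (σ i)

mutual
  subT : ∀ {n m} → (Fin n → Val m) → Tm n → Tm m
  subT σ (val v)   = val (subV σ v)
  subT σ (app t v) = app (subT σ t) (subV σ v)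

  subV : ∀ {n m} → (Fin n → Val m) → Val n → Val m
  subV σ (var i) = σ i
  subV σ (lam t) = lam (subT (exts σ) t)

-- t{x:=u}, x being the variable bound by the outermost binder (index 0)
_[x:=_] : ∀ {n} → Tm (suc n) → Val n → Tm n
t [x:= u ] = subT σ t
  where
  σ : _ → _
  σ zero    = u
  σ (suc i) = var i

weaken : ∀ {n} → Tm 0 → Tm n
weaken = renT (λ ())

infix 4 _⟶_
data _⟶_ {n : ℕ} : Tm n → Tm n → Set where
  β   : ∀ {t : Tm (suc n)} {u : Val n} → app (val (lam t)) u ⟶ t [x:= u ]
  ctx : ∀ {t t' : Tm n} {v : Val n} → t ⟶ t' → app t v ⟶ app t' v

infix 4 _⟶⟨_⟩_
data _⟶⟨_⟩_ {n : ℕ} : Tm n → ℕ → Tm n → Set where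
  done : ∀ {t} → t ⟶⟨ 0 ⟩ t
  more : ∀ {t t' t'' k} → t ⟶ t' → t' ⟶⟨ k ⟩ t'' → t ⟶⟨ suc k ⟩ t''

Diverges : ∀ {n} → Tm n → Set
Diverges {n} t = Σ (ℕ → Tm n) λ f → (f 0 ≡ t) × (∀ j → f j ⟶ f (suc j))

-- Scott encodings (closed values, usable in any scope n)

-- lamV m t  =  λ^(m+1). t
lamV : ∀ {n} m → Tm (suc m + n) → Val n
lamV zero    t = lam t
lamV (suc m) t = lamV m (val (lam t))

-- ⌈a_j⌉ = λx_1…λx_m. x_j  for the alphabet Fin m (order = order of Fin m)
encSym : ∀ {n m} → Fin m → Val n
encSym {n} {suc m} j = lamV m (val (var (opposite j ↑ˡ n)))

-- ⌈ε⌉ = λx_1…λx_m.λx_ε.x_ε ,  ⌈a_j r⌉ = λx_1…λx_m.λx_ε.x_j ⌈r⌉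
encStr : ∀ {n} m → List (Fin m) → Val n
encStr {n} m []      = lamV m (val (var zero))
encStr {n} m (j ∷ r) = lamV m (app (val (var (suc (opposite j ↑ˡ n)))) (encStr m r))

data Bit : Set where
  b0 b1 : Bit

data BI : Set where
  i0 i1 iL iR : BI

data BW : Set where
  w0 w1 blank : BW

bitIdx : Bit → Fin 2
bitIdx b0 = zero
bitIdx b1 = suc zero

biIdx : BI → Fin 4
biIdx i0 = zero
biIdx i1 = suc zero
biIdx iL = suc (suc zero)
biIdx iR = suc (suc (suc zero))

bwIdx : BW → Fin 3
bwIdx w0    = zero
bwIdx w1    = suc zero
bwIdx blank = suc (suc zero)

bitToBI : Bit → BI
bitToBI b0 = i0
bitToBI b1 = i1

-- bin(n): reversed binary representation without trailing zeros,
-- defined by binary increment: bin 0 = ε, bin (n+1) = inc (bin n)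
incBin : List Bit → List Bit
incBin []       = b1 ∷ []
incBin (b0 ∷ r) = b1 ∷ r
incBin (b1 ∷ r) = b0 ∷ incBin r

bin : ℕ → List Bit
bin zero    = []
bin (suc n) = incBin (bin n)

data Dir : Set where
  minus plus stay : Dir

data Move : Set where
  left right down : Move

record TM : Set where
  field
    q      : ℕ                       -- Q = Fin q (its order is the fixed order on Q)
    sIn    : Fin q
    sT     : Fin q
    sF     : Fin q
    δ      : BI → BW → Fin q → Maybe (Dir × BW × Move × Fin q)
    δ-sT   : ∀ c a → δ c a sT ≡ nothing
    δ-sF   : ∀ c a → δ c a sF ≡ nothing
    δ-L    : ∀ a s d a' m s' → δ iL a s ≡ just (d , a' , m , s') → d ≢ minus
    δ-R    : ∀ a s d a' m s' → δ iR a s ≡ just (d , a' , m , s') → d ≢ plus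

inputStr : List Bit → List BI
inputStr u = iL ∷ (map bitToBI u ++ [ iR ])

-- configurations (i, n | w_l, a, w_r | s) with i = L·u·R and 0 ≤ n < |i|
record Config (q : ℕ) : Set where
  constructor config
  field
    inp  : List Bit
    pos  : ℕ
    pos< : pos < length (inputStr inp)
    wl   : List BW           -- w_l (in left-to-right order)
    sym  : BW
    wr   : List BW
    st   : Fin q
open Config public

inputLength : ∀ {q} → Config q → ℕ
inputLength C = length (inputStr (inp C))

scanned : ∀ {q} → Config q → BI
scanned C = lookup (inputStr (inp C)) (fromℕ< (pos< C))

data HeadMove : Dir → ℕ → ℕ → Set where
  mvMinus : ∀ {n} → HeadMove minus (suc n) n
  mvPlus  : ∀ {n} → HeadMove plus n (suc n)
  mvStay  : ∀ {n} → HeadMove stay n n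

workMove : Move → List BW → BW → List BW → List BW × BW × List BW
workMove down  wl a' wr = wl , a' , wr
workMove left  wl a' wr with reverse wl
... | []     = [] , blank , a' ∷ wr
... | b ∷ rw = reverse rw , b , a' ∷ wr          -- w_l = (reverse rw)·b
workMove right wl a' []      = wl ++ [ a' ] , blank , []
workMove right wl a' (b ∷ w) = wl ++ [ a' ] , b , w

module _ (M : TM) where
  open TM M

  Final : Config q → Set
  Final C = (st C ≡ sT) ⊎ (st C ≡ sF)

  data Step (C D : Config q) : Set where
    step : ∀ {d a' m s'}
         → δ (scanned C) (sym C) (st C) ≡ just (d , a' , m , s')
         → inp D ≡ inp C
         → HeadMove d (pos C) (pos D)
         → (wl D , sym D , wr D) ≡ workMove m (wl C) a' (wr C)
         → st D ≡ s'
         → Step C D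

  data Steps : Config q → ℕ → Config q → Set where
    here  : ∀ {C} → Steps C 0 C
    there : ∀ {C C' D k} → Step C C' → Steps C' k D → Steps C (suc k) D

  encConfig : ∀ {n} → Config q → Val n
  encConfig C =
    lam (app (app (app (app (app (app (val (var zero))
      (encStr 4 (map biIdx (inputStr (inp C)))))
      (encStr 2 (map bitIdx (bin (pos C)))))
      (encStr 3 (map bwIdx (reverse (wl C)))))
      (encSym (bwIdx (sym C))))
      (encStr 3 (map bwIdx (wr C))))
      (encSym (st C)))

cost : ∀ {q} → Config q → ℕ
cost C = inputLength C * ⌊log₂ inputLength C ⌋

module Submission where

-- trans = stepTm stepTm is a Scott-style interpreter. Applied to k and ⌈C⌉, it lets ⌈C⌉ hand over its six
-- components, fetches the scanned input character by walking down ⌈i⌉ while decrementing ⌈bin n⌉,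
-- and selects, by that character, the scanned work symbol and the state, a leaf of a finite table:
-- k ⌈C⌉ for final states, the looping ω ω where δ is undefined, and otherwise a binary increment or
-- decrement of the head position and a pop/push at the head of the work tape, after which trans is
-- called again on the new configuration. Each phase is an exact count of β-steps: the walk costs
-- O(n log |i|) ⊆ O(|i| log |i|), the rest O(log |i|). Since →det is deterministic, a run that can
-- always be prolonged is a single infinite reduction.

open import Defs hiding (sym)
open import Data.Empty using (⊥-elim)
open import Data.Fin using (Fin; zero; suc; opposite; _↑ˡ_; _↑ʳ_; fromℕ; fromℕ<; inject₁)
open import Data.Fin.Properties using (opposite-involutive; _≟_)
open import Data.List using (List; []; _∷_; _++_; _ʳ++_; [_]; map; length; lookup; reverse)
open import Data.List.Properties using (length-++; reverse-++; reverse-involutive)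
open import Data.Maybe using (Maybe; just; nothing)
open import Data.Nat using (ℕ; zero; suc; _+_; _*_; _^_; _≤_; _<_; z≤n; s≤s)
open import Data.Nat.Logarithm using (⌊log₂_⌋; ⌊log₂⌋-mono-≤; ⌊log₂[2^n]⌋≡n; ⌊log₂[2*b]⌋≡1+⌊log₂b⌋)
open import Data.Nat.Properties
  using ( +-comm; +-identityʳ; *-identityˡ; *-identityʳ; *-suc; *-distribˡ-+; +-mono-≤; +-monoˡ-≤; +-monoʳ-≤
        ; *-monoˡ-≤; *-monoʳ-≤; ≤-refl; ≤-reflexive; ≤-trans; <-trans; <⇒≤; m≤m+n; m≤n+m; n≤1+n; n<1+n
        ; m≤n⇒m<n∨m≡n; suc-injective; module ≤-Reasoning)
open import Data.Nat.Tactic.RingSolver using (solve-∀)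
open import Data.Product using (Σ; _×_; _,_; ∃; proj₁; proj₂)
open import Data.Sum using (_⊎_; inj₁; inj₂)
open import Function using (_∘_)
open import Relation.Binary.PropositionalEquality
  using (_≡_; refl; sym; trans; cong; cong₂; subst; _≗_)
open import Relation.Nullary using (Dec; yes; no; ¬_)
open import Relation.Nullary.Decidable using (_⊎-dec_)

mutual
  renT-cong : ∀ {n m} {ρ ρ' : Fin n → Fin m} → ρ ≗ ρ' → renT ρ ≗ renT ρ'
  renT-cong h (val v)   = cong val (renV-cong h v)
  renT-cong h (app t v) = cong₂ app (renT-cong h t) (renV-cong h v)

  renV-cong : ∀ {n m} {ρ ρ' : Fin n → Fin m} → ρ ≗ ρ' → renV ρ ≗ renV ρ'
  renV-cong h (var i) = cong var (h i)
  renV-cong h (lam t) = cong lam (renT-cong (ext-cong h) t)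
    where
    ext-cong : ∀ {n m} {ρ ρ' : Fin n → Fin m} → ρ ≗ ρ' → ext ρ ≗ ext ρ'
    ext-cong h zero    = refl
    ext-cong h (suc i) = cong suc (h i)

mutual
  subT-cong : ∀ {n m} {σ σ' : Fin n → Val m} → σ ≗ σ' → subT σ ≗ subT σ'
  subT-cong h (val v)   = cong val (subV-cong h v)
  subT-cong h (app t v) = cong₂ app (subT-cong h t) (subV-cong h v)

  subV-cong : ∀ {n m} {σ σ' : Fin n → Val m} → σ ≗ σ' → subV σ ≗ subV σ'
  subV-cong h (var i) = h i
  subV-cong h (lam t) = cong lam (subT-cong (exts-cong h) t)
    where
    exts-cong : ∀ {n m} {σ σ' : Fin n → Val m} → σ ≗ σ' → exts σ ≗ exts σ'
    exts-cong h zero    = refl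
    exts-cong h (suc i) = cong (renV suc) (h i)

mutual
  renT-renT : ∀ {n m k} (ρ : Fin m → Fin k) (ρ' : Fin n → Fin m) t →
              renT ρ (renT ρ' t) ≡ renT (ρ ∘ ρ') t
  renT-renT ρ ρ' (val v)   = cong val (renV-renV ρ ρ' v)
  renT-renT ρ ρ' (app t v) = cong₂ app (renT-renT ρ ρ' t) (renV-renV ρ ρ' v)

  renV-renV : ∀ {n m k} (ρ : Fin m → Fin k) (ρ' : Fin n → Fin m) v →
              renV ρ (renV ρ' v) ≡ renV (ρ ∘ ρ') v
  renV-renV ρ ρ' (var i) = refl
  renV-renV ρ ρ' (lam t) =
    cong lam (trans (renT-renT (ext ρ) (ext ρ') t) (renT-cong (λ { zero → refl ; (suc i) → refl }) t))

mutual
  subT-renT : ∀ {n m k} (σ : Fin m → Val k) (ρ : Fin n → Fin m) t →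
              subT σ (renT ρ t) ≡ subT (σ ∘ ρ) t
  subT-renT σ ρ (val v)   = cong val (subV-renV σ ρ v)
  subT-renT σ ρ (app t v) = cong₂ app (subT-renT σ ρ t) (subV-renV σ ρ v)

  subV-renV : ∀ {n m k} (σ : Fin m → Val k) (ρ : Fin n → Fin m) v →
              subV σ (renV ρ v) ≡ subV (σ ∘ ρ) v
  subV-renV σ ρ (var i) = refl
  subV-renV σ ρ (lam t) =
    cong lam (trans (subT-renT (exts σ) (ext ρ) t) (subT-cong (λ { zero → refl ; (suc i) → refl }) t))

mutual
  renT-subT : ∀ {n m k} (ρ : Fin m → Fin k) (σ : Fin n → Val m) t →
              renT ρ (subT σ t) ≡ subT (renV ρ ∘ σ) t
  renT-subT ρ σ (val v)   = cong val (renV-subV ρ σ v)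
  renT-subT ρ σ (app t v) = cong₂ app (renT-subT ρ σ t) (renV-subV ρ σ v)

  renV-subV : ∀ {n m k} (ρ : Fin m → Fin k) (σ : Fin n → Val m) v →
              renV ρ (subV σ v) ≡ subV (renV ρ ∘ σ) v
  renV-subV ρ σ (var i) = refl
  renV-subV ρ σ (lam t) = cong lam (trans (renT-subT (ext ρ) (exts σ) t) (subT-cong h t))
    where
    h : renV (ext ρ) ∘ exts σ ≗ exts (renV ρ ∘ σ)
    h zero    = refl
    h (suc i) = trans (renV-renV (ext ρ) suc (σ i)) (sym (renV-renV suc ρ (σ i)))

mutual
  subT-subT : ∀ {n m k} (τ : Fin m → Val k) (σ : Fin n → Val m) t →
              subT τ (subT σ t) ≡ subT (subV τ ∘ σ) t
  subT-subT τ σ (val v)   = cong val (subV-subV τ σ v)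
  subT-subT τ σ (app t v) = cong₂ app (subT-subT τ σ t) (subV-subV τ σ v)

  subV-subV : ∀ {n m k} (τ : Fin m → Val k) (σ : Fin n → Val m) v →
              subV τ (subV σ v) ≡ subV (subV τ ∘ σ) v
  subV-subV τ σ (var i) = refl
  subV-subV τ σ (lam t) = cong lam (trans (subT-subT (exts τ) (exts σ) t) (subT-cong h t))
    where
    h : subV (exts τ) ∘ exts σ ≗ exts (subV τ ∘ σ)
    h zero    = refl
    h (suc i) = trans (subV-renV (exts τ) suc (σ i)) (sym (renV-subV suc τ (σ i)))

mutual
  subT-var : ∀ {n} (t : Tm n) → subT var t ≡ t
  subT-var (val v)   = cong val (subV-var v)
  subT-var (app t v) = cong₂ app (subT-var t) (subV-var v)

  subV-var : ∀ {n} (v : Val n) → subV var v ≡ v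
  subV-var (var i) = refl
  subV-var (lam t) = cong lam (trans (subT-cong (λ { zero → refl ; (suc i) → refl }) t) (subT-var t))

mutual
  renT≡subT : ∀ {n m} (ρ : Fin n → Fin m) t → renT ρ t ≡ subT (var ∘ ρ) t
  renT≡subT ρ (val v)   = cong val (renV≡subV ρ v)
  renT≡subT ρ (app t v) = cong₂ app (renT≡subT ρ t) (renV≡subV ρ v)

  renV≡subV : ∀ {n m} (ρ : Fin n → Fin m) v → renV ρ v ≡ subV (var ∘ ρ) v
  renV≡subV ρ (var i) = refl
  renV≡subV ρ (lam t) =
    cong lam (trans (renT≡subT (ext ρ) t) (subT-cong (λ { zero → refl ; (suc i) → refl }) t))

infixr 5 _⟫_
_⟫_ : ∀ {n} {t u w : Tm n} {a b} → t ⟶⟨ a ⟩ u → u ⟶⟨ b ⟩ w → t ⟶⟨ a + b ⟩ w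
done     ⟫ q = q
more s p ⟫ q = more s (p ⟫ q)

ctx* : ∀ {n} {t t' : Tm n} {a} (v : Val n) → t ⟶⟨ a ⟩ t' → app t v ⟶⟨ a ⟩ app t' v
ctx* v done       = done
ctx* v (more s p) = more (ctx s) (ctx* v p)

infixl 5 _∷ʳ_
_∷ʳ_ : ∀ {n} {t u w : Tm n} {a} → t ⟶⟨ a ⟩ u → u ⟶ w → t ⟶⟨ suc a ⟩ w
done     ∷ʳ s = more s done
more s p ∷ʳ s' = more s (p ∷ʳ s')

cast-source : ∀ {n} {t t' u : Tm n} {a} → t ≡ t' → t' ⟶⟨ a ⟩ u → t ⟶⟨ a ⟩ u
cast-source refl p = p

cast-steps : ∀ {n} {t u : Tm n} {a b} → a ≡ b → t ⟶⟨ a ⟩ u → t ⟶⟨ b ⟩ u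
cast-steps refl p = p

cast-target : ∀ {n} {t u u' : Tm n} {a} → u ≡ u' → t ⟶⟨ a ⟩ u → t ⟶⟨ a ⟩ u'
cast-target refl p = p

⟶-deterministic : ∀ {n} {t t₁ t₂ : Tm n} → t ⟶ t₁ → t ⟶ t₂ → t₁ ≡ t₂
⟶-deterministic β       β        = refl
⟶-deterministic β       (ctx ())
⟶-deterministic (ctx ()) β
⟶-deterministic (ctx {v = v} s) (ctx s') = cong (λ t → app t v) (⟶-deterministic s s')

⟶⟨⟩-deterministic : ∀ {n j} {t u u' : Tm n} → t ⟶⟨ j ⟩ u → t ⟶⟨ j ⟩ u' → u ≡ u'
⟶⟨⟩-deterministic done       done         = refl
⟶⟨⟩-deterministic (more s p) (more s' p') with ⟶-deterministic s s'
... | refl = ⟶⟨⟩-deterministic p p'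

⟶⟨⟩-unsnoc : ∀ {n j} {t u : Tm n} → t ⟶⟨ suc j ⟩ u → Σ (Tm n) λ w → (t ⟶⟨ j ⟩ w) × (w ⟶ u)
⟶⟨⟩-unsnoc (more s done)         = _ , done , s
⟶⟨⟩-unsnoc (more s p@(more _ _)) with ⟶⟨⟩-unsnoc p
... | w , p' , s' = w , more s p' , s'

⟶⟨⟩-prefix : ∀ {n j m} {t u : Tm n} → j ≤ m → t ⟶⟨ m ⟩ u → Σ (Tm n) λ u' → t ⟶⟨ j ⟩ u'
⟶⟨⟩-prefix z≤n       _          = _ , done
⟶⟨⟩-prefix (s≤s j≤m) (more s p) = let u' , p' = ⟶⟨⟩-prefix j≤m p in u' , more s p'

RunsAtLeast : ∀ {n} → Tm n → ℕ → Set
RunsAtLeast {n} t j = Σ ℕ λ m → (j ≤ m) × Σ (Tm n) λ u → t ⟶⟨ m ⟩ u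

unbounded⇒diverges : ∀ {n} {t : Tm n} → (∀ j → RunsAtLeast t j) → Diverges t
unbounded⇒diverges {n} {t} long = proj₁ ∘ runs , start (proj₂ (runs 0)) , next
  where
  runs : ∀ j → Σ (Tm n) λ u → t ⟶⟨ j ⟩ u
  runs j = let _ , j≤m , _ , r = long j in ⟶⟨⟩-prefix j≤m r
  start : ∀ {u} → t ⟶⟨ 0 ⟩ u → u ≡ t
  start done = refl
  next : ∀ j → proj₁ (runs j) ⟶ proj₁ (runs (suc j))
  next j with ⟶⟨⟩-unsnoc (proj₂ (runs (suc j)))
  ... | w , p , s = subst (_⟶ proj₁ (runs (suc j))) (⟶⟨⟩-deterministic p (proj₂ (runs j))) s

infixl 6 _▷_
data Args (n : ℕ) : ℕ → Set where
  ε   : Args n 0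
  _▷_ : ∀ {a} → Args n a → Val n → Args n (suc a)

infixl 5 _◂_
_◂_ : ∀ {n a} → Tm n → Args n a → Tm n
t ◂ ε        = t
t ◂ (as ▷ v) = app (t ◂ as) v

ctx◂ : ∀ {n a k} {t t' : Tm n} (as : Args n a) → t ⟶⟨ k ⟩ t' → t ◂ as ⟶⟨ k ⟩ t' ◂ as
ctx◂ ε        p = p
ctx◂ (as ▷ v) p = ctx* v (ctx◂ as p)

◂-cong₆ : ∀ {n} (h : Tm n) {v₁ v₁' v₂ v₂' v₃ v₃' v₄ v₄' v₅ v₅' v₆ v₆' : Val n} →
          v₁ ≡ v₁' → v₂ ≡ v₂' → v₃ ≡ v₃' → v₄ ≡ v₄' → v₅ ≡ v₅' → v₆ ≡ v₆' →
          h ◂ (ε ▷ v₁ ▷ v₂ ▷ v₃ ▷ v₄ ▷ v₅ ▷ v₆) ≡ h ◂ (ε ▷ v₁' ▷ v₂' ▷ v₃' ▷ v₄' ▷ v₅' ▷ v₆')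
◂-cong₆ h refl refl refl refl refl refl = refl

-- The substitution instantiating the a binders of λ^a with a spine (the last argument is variable 0).
env : ∀ {n a} → Args n a → Fin (a + n) → Val n
env ε        i       = var i
env (as ▷ v) zero    = v
env (as ▷ v) (suc i) = env as i

mapA : ∀ {n m a} → (Val n → Val m) → Args n a → Args m a
mapA f ε        = ε
mapA f (as ▷ v) = mapA f as ▷ f v

subT-◂ : ∀ {n m a} (σ : Fin n → Val m) (t : Tm n) (as : Args n a) →
         subT σ (t ◂ as) ≡ subT σ t ◂ mapA (subV σ) as
subT-◂ σ t ε        = refl
subT-◂ σ t (as ▷ v) = cong (λ z → app z (subV σ v)) (subT-◂ σ t as)

tabA : ∀ {n} m → (Fin m → Val n) → Args n m
tabA zero    f = ε
tabA (suc m) f = tabA m (f ∘ inject₁) ▷ f (fromℕ m)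

mapA-tabA : ∀ {n n'} m (g : Val n → Val n') (f : Fin m → Val n) → mapA g (tabA m f) ≡ tabA m (g ∘ f)
mapA-tabA zero    g f = refl
mapA-tabA (suc m) g f = cong (_▷ g (f (fromℕ m))) (mapA-tabA m g (f ∘ inject₁))

tabA-cong : ∀ {n} m {f g : Fin m → Val n} → f ≗ g → tabA m f ≡ tabA m g
tabA-cong zero    h = refl
tabA-cong (suc m) h = cong₂ _▷_ (tabA-cong m (h ∘ inject₁)) (h (fromℕ m))

env-tabA : ∀ {n} m (f : Fin m → Val n) (j : Fin m) → env (tabA m f) (opposite j ↑ˡ n) ≡ f j
env-tabA m f j = trans (go m f (opposite j)) (cong f (opposite-involutive j))
  where
  go : ∀ {n} m (f : Fin m → Val n) (i : Fin m) → env (tabA m f) (i ↑ˡ n) ≡ f (opposite i)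
  go (suc m) f zero    = refl
  go (suc m) f (suc i) = go m (f ∘ inject₁) i

β-lamV : ∀ {n} m (t : Tm (suc m + n)) (as : Args n (suc m)) →
         val (lamV m t) ◂ as ⟶⟨ suc m ⟩ subT (env as) t
β-lamV zero t (ε ▷ v) = cast-target (subT-cong (λ { zero → refl ; (suc i) → refl }) t) (more β done)
β-lamV {n} (suc m) t (as ▷ v) =
  ctx* v (β-lamV m (val (lam t)) as) ∷ʳ subst (app (val (lam (subT (exts (env as)) t))) v ⟶_) eq β
  where
  σ₁ : Fin (suc n) → Val n
  σ₁ zero    = v
  σ₁ (suc i) = var i
  h : subV σ₁ ∘ exts (env as) ≗ env (as ▷ v)
  h zero    = refl
  h (suc i) = trans (subV-renV σ₁ suc (env as i)) (subV-var (env as i))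
  eq : subT (exts (env as)) t [x:= v ] ≡ subT (env (as ▷ v)) t
  eq = trans (subT-cong (λ { zero → refl ; (suc i) → refl }) (subT (exts (env as)) t))
             (trans (subT-subT σ₁ (exts (env as)) t) (subT-cong h t))

Closed : (∀ {k} → Val k) → Set
Closed v = ∀ {k k'} (σ : Fin k → Val k') → subV σ (v {k}) ≡ v {k'}

extsN : ∀ k {n n'} → (Fin n → Val n') → Fin (k + n) → Val (k + n')
extsN zero    σ = σ
extsN (suc k) σ = exts (extsN k σ)

subV-lamV : ∀ {n n'} m (σ : Fin n → Val n') (t : Tm (suc m + n)) →
            subV σ (lamV m t) ≡ lamV m (subT (extsN (suc m) σ) t)
subV-lamV zero    σ t = refl
subV-lamV (suc m) σ t = subV-lamV m σ (val (lam t))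

extsN-↑ˡ : ∀ k {n n'} (σ : Fin n → Val n') (i : Fin k) → extsN k σ (i ↑ˡ n) ≡ var (i ↑ˡ n')
extsN-↑ˡ (suc k) σ zero    = refl
extsN-↑ˡ (suc k) σ (suc i) = cong (renV suc) (extsN-↑ˡ k σ i)

extsN-↑ʳ : ∀ k {n n'} (σ : Fin n → Val n') (i : Fin n) → extsN k σ (k ↑ʳ i) ≡ renV (k ↑ʳ_) (σ i)
extsN-↑ʳ zero    σ i = sym (trans (renV≡subV (λ j → j) (σ i)) (subV-var (σ i)))
extsN-↑ʳ (suc k) σ i = trans (cong (renV suc) (extsN-↑ʳ k σ i)) (renV-renV suc (k ↑ʳ_) (σ i))

subV-encStr : ∀ {n n'} (σ : Fin n → Val n') m (l : List (Fin m)) → subV σ (encStr m l) ≡ encStr m l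
subV-encStr σ m []      = subV-lamV m σ _
subV-encStr σ m (j ∷ r) = trans (subV-lamV m σ _) (cong (lamV m) (cong₂ (λ a b → app (val a) b)
  (extsN-↑ˡ (suc m) σ (suc (opposite j))) (subV-encStr (extsN (suc m) σ) m r)))

subV-encSym : ∀ {n n'} (σ : Fin n → Val n') {m} (j : Fin m) → subV σ (encSym j) ≡ encSym j
subV-encSym σ {suc m} j = trans (subV-lamV m σ _) (cong (lamV m ∘ val) (extsN-↑ˡ (suc m) σ (opposite j)))

renV-encStr : ∀ {n n'} (ρ : Fin n → Fin n') m (l : List (Fin m)) → renV ρ (encStr m l) ≡ encStr m l
renV-encStr ρ m l = trans (renV≡subV ρ _) (subV-encStr _ m l)

renV-encSym : ∀ {n n'} (ρ : Fin n → Fin n') {m} (j : Fin m) → renV ρ (encSym j) ≡ encSym j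
renV-encSym ρ j = trans (renV≡subV ρ _) (subV-encSym _ j)

encSym-case : ∀ {n} m (j : Fin m) (f : Fin m → Val n) → val (encSym j) ◂ tabA m f ⟶⟨ m ⟩ val (f j)
encSym-case (suc m) j f = cast-target (cong val (env-tabA (suc m) f j)) (β-lamV m _ (tabA (suc m) f))

encStr-[]-case : ∀ {n} m (f : Fin m → Val n) (b : Val n) →
                 val (encStr m []) ◂ (tabA m f ▷ b) ⟶⟨ suc m ⟩ val b
encStr-[]-case m f b = β-lamV m _ (tabA m f ▷ b)

encStr-∷-case : ∀ {n} m (j : Fin m) r (f : Fin m → Val n) (b : Val n) →
                val (encStr m (j ∷ r)) ◂ (tabA m f ▷ b) ⟶⟨ suc m ⟩ app (val (f j)) (encStr m r)
encStr-∷-case m j r f b =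
  cast-target (cong₂ (λ x y → app (val x) y) (env-tabA m f j) (subV-encStr _ m r)) (β-lamV m _ (tabA m f ▷ b))

x0 : ∀ {n} → Val (suc n)
x0 = var zero
x1 : ∀ {n} → Val (2 + n)
x1 = var (suc zero)
x2 : ∀ {n} → Val (3 + n)
x2 = var (suc (suc zero))
x3 : ∀ {n} → Val (4 + n)
x3 = var (suc (suc (suc zero)))
x4 : ∀ {n} → Val (5 + n)
x4 = var (suc (suc (suc (suc zero))))
x5 : ∀ {n} → Val (6 + n)
x5 = var (suc (suc (suc (suc (suc zero)))))
x6 : ∀ {n} → Val (7 + n)
x6 = var (suc (suc (suc (suc (suc (suc zero))))))
x7 : ∀ {n} → Val (8 + n)
x7 = var (suc (suc (suc (suc (suc (suc (suc zero)))))))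
x8 : ∀ {n} → Val (9 + n)
x8 = var (suc (suc (suc (suc (suc (suc (suc (suc zero))))))))
x9 : ∀ {n} → Val (10 + n)
x9 = var (suc (suc (suc (suc (suc (suc (suc (suc (suc zero)))))))))
x10 : ∀ {n} → Val (11 + n)
x10 = var (suc (suc (suc (suc (suc (suc (suc (suc (suc (suc zero))))))))))

-- cons m j = λ l K. K ⌈j ∷ l⌉, the cell λx₁…xₘ x_ε. x_j l referring to l across its m + 1 binders.
consCell : ∀ {n} m → Fin m → Val (2 + n)
consCell {n} m j = lamV m (app (val (var (suc (opposite j ↑ˡ (2 + n))))) (var (suc m ↑ʳ suc zero)))

cons : ∀ {n} m → Fin m → Val n
cons m j = lamV 1 (app (val x0) (consCell m j))

subV-consCell : ∀ {n n'} (σ : Fin n → Val n') m (j : Fin m) →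
                subV (extsN 2 σ) (consCell m j) ≡ consCell m j
subV-consCell σ m j = trans (subV-lamV m (extsN 2 σ) _) (cong₂ (λ a b → lamV m (app (val a) b))
  (extsN-↑ˡ (suc m) (extsN 2 σ) (suc (opposite j)))
  (extsN-↑ʳ (suc m) (extsN 2 σ) (suc zero)))

subV-cons : ∀ {n n'} (σ : Fin n → Val n') m (j : Fin m) → subV σ (cons m j) ≡ cons m j
subV-cons σ m j = trans (subV-lamV 1 σ (app (val x0) (consCell m j)))
  (cong (λ c → lamV 1 (app (val x0) c)) (subV-consCell σ m j))

cons-reduces : ∀ {n} m j l (K : Val n) →
               val (cons m j) ◂ (ε ▷ encStr m l ▷ K) ⟶⟨ 2 ⟩ app (val K) (encStr m (j ∷ l))
cons-reduces {n} m j l K = cast-target (cong (app (val K)) cell) (β-lamV 1 _ (ε ▷ encStr m l ▷ K))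
  where
  σ : Fin (2 + n) → Val n
  σ = env (ε ▷ encStr m l ▷ K)
  cell : subV σ (consCell m j) ≡ encStr m (j ∷ l)
  cell = trans (subV-lamV m σ _) (cong₂ (λ a b → lamV m (app (val a) b))
    (extsN-↑ˡ (suc m) σ (suc (opposite j)))
    (trans (extsN-↑ʳ (suc m) σ (suc zero)) (renV-encStr _ m l)))

encBits : ∀ {n} → List Bit → Val n
encBits l = encStr 2 (map bitIdx l)

-- The recursive combinators below receive themselves as first argument (self-application).

revRecurse : ∀ {n} → Val n
revRecurse = lamV 3 (val x2 ◂ (ε ▷ x2 ▷ x1 ▷ x3 ▷ x0))

revConsCase : ∀ {n} → Fin 2 → Val n
revConsCase b = lamV 3 (val (cons 2 b) ◂ (ε ▷ x1 ▷ revRecurse ▷ x2 ▷ x3 ▷ x0))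

revNilCase : ∀ {n} → Val n
revNilCase = lamV 2 (val x0 ◂ (ε ▷ x1))

revTmBody : ∀ {n} → Tm (4 + n)
revTmBody = val x2 ◂ (tabA 2 revConsCase ▷ revNilCase ▷ x3 ▷ x1 ▷ x0)

revTm : ∀ {n} → Val n
revTm = lamV 3 revTmBody

revCost : List Bit → ℕ
revCost acc = length acc * 17 + 10

revTm-reduces : ∀ {n} acc l (K : Val n) →
  val revTm ◂ (ε ▷ revTm ▷ encBits acc ▷ encBits l ▷ K) ⟶⟨ revCost acc ⟩ app (val K) (encBits (acc ʳ++ l))
revTm-reduces [] l K =
  β-lamV 3 revTmBody _
  ⟫ ctx◂ (ε ▷ revTm ▷ encBits l ▷ K) (encStr-[]-case 2 revConsCase revNilCase)
  ⟫ β-lamV 2 _ (ε ▷ revTm ▷ encBits l ▷ K)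
revTm-reduces (b ∷ acc) l K =
  β-lamV 3 revTmBody _
  ⟫ ctx◂ (ε ▷ revTm ▷ encBits l ▷ K) (encStr-∷-case 2 (bitIdx b) (map bitIdx acc) revConsCase revNilCase)
  ⟫ cast-target (cong (λ c → val c ◂ (ε ▷ encBits l ▷ revRecurse ▷ revTm ▷ encBits acc ▷ K)) (subV-cons _ 2 (bitIdx b)))
      (β-lamV 3 _ (ε ▷ encBits acc ▷ revTm ▷ encBits l ▷ K))
  ⟫ ctx◂ (ε ▷ revTm ▷ encBits acc ▷ K) (cons-reduces 2 (bitIdx b) (map bitIdx l) revRecurse)
  ⟫ β-lamV 3 _ (ε ▷ encBits (b ∷ l) ▷ revTm ▷ encBits acc ▷ K)
  ⟫ revTm-reduces acc (b ∷ l) K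

recurse : ∀ {n} → Val n
recurse = lamV 3 (val x2 ◂ (ε ▷ x2 ▷ x3 ▷ x1 ▷ x0))

revOnto : ∀ {n} → Val n
revOnto = lamV 2 (val revTm ◂ (ε ▷ revTm ▷ x1 ▷ x2 ▷ x0))

incCase : ∀ {n} → Fin 2 → Val n
incCase zero    = lamV 3 (val (cons 2 (suc zero)) ◂ (ε ▷ x3 ▷ revOnto ▷ x1 ▷ x0))
incCase (suc _) = lamV 3 (val (cons 2 zero) ◂ (ε ▷ x1 ▷ recurse ▷ x2 ▷ x3 ▷ x0))

incNil : ∀ {n} → Val n
incNil = lamV 2 (val revTm ◂ (ε ▷ revTm ▷ x1 ▷ encBits (b1 ∷ []) ▷ x0))

incTmBody : ∀ {n} → Tm (4 + n)
incTmBody = val x1 ◂ (tabA 2 incCase ▷ incNil ▷ x3 ▷ x2 ▷ x0)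

incTm : ∀ {n} → Val n
incTm = lamV 3 incTmBody

incCost : List Bit → List Bit → ℕ
incCost acc []       = 10 + revCost acc
incCost acc (b0 ∷ r) = 16 + revCost acc
incCost acc (b1 ∷ r) = 17 + incCost (b0 ∷ acc) r

incTm-reduces : ∀ {n} acc l (K : Val n) →
  val incTm ◂ (ε ▷ incTm ▷ encBits acc ▷ encBits l ▷ K) ⟶⟨ incCost acc l ⟩
  app (val K) (encBits (acc ʳ++ incBin l))
incTm-reduces acc [] K =
  β-lamV 3 incTmBody _
  ⟫ ctx◂ (ε ▷ incTm ▷ encBits acc ▷ K) (encStr-[]-case 2 incCase incNil)
  ⟫ β-lamV 2 _ (ε ▷ incTm ▷ encBits acc ▷ K)
  ⟫ revTm-reduces acc (b1 ∷ []) K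
incTm-reduces acc (b0 ∷ r) K =
  β-lamV 3 incTmBody _
  ⟫ ctx◂ (ε ▷ incTm ▷ encBits acc ▷ K) (encStr-∷-case 2 zero (map bitIdx r) incCase incNil)
  ⟫ β-lamV 3 _ (ε ▷ encBits r ▷ incTm ▷ encBits acc ▷ K)
  ⟫ ctx◂ (ε ▷ encBits acc ▷ K) (cons-reduces 2 (suc zero) (map bitIdx r) revOnto)
  ⟫ β-lamV 2 _ (ε ▷ encBits (b1 ∷ r) ▷ encBits acc ▷ K)
  ⟫ revTm-reduces acc (b1 ∷ r) K
incTm-reduces acc (b1 ∷ r) K =
  β-lamV 3 incTmBody _
  ⟫ ctx◂ (ε ▷ incTm ▷ encBits acc ▷ K) (encStr-∷-case 2 (suc zero) (map bitIdx r) incCase incNil)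
  ⟫ β-lamV 3 _ (ε ▷ encBits r ▷ incTm ▷ encBits acc ▷ K)
  ⟫ ctx◂ (ε ▷ incTm ▷ encBits r ▷ K) (cons-reduces 2 zero (map bitIdx acc) recurse)
  ⟫ β-lamV 3 _ (ε ▷ encBits (b0 ∷ acc) ▷ incTm ▷ encBits r ▷ K)
  ⟫ incTm-reduces (b0 ∷ acc) r K

-- decBin [] = [] is a junk value.
decBin : List Bit → List Bit
decBin []           = []
decBin (b0 ∷ r)     = b1 ∷ decBin r
decBin (b1 ∷ [])    = []
decBin (b1 ∷ c ∷ r) = b0 ∷ c ∷ r

decEmpty : ∀ {n} → Val n
decEmpty = lamV 2 (val revTm ◂ (ε ▷ revTm ▷ x1 ▷ encBits [] ▷ x0))

decNonEmpty : ∀ {n} → Val n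
decNonEmpty = lamV 3 (val (cons 2 zero) ◂ (ε ▷ x2 ▷ revOnto ▷ x1 ▷ x0))

decCase : ∀ {n} → Fin 2 → Val n
decCase zero    = lamV 3 (val (cons 2 (suc zero)) ◂ (ε ▷ x1 ▷ recurse ▷ x2 ▷ x3 ▷ x0))
decCase (suc _) = lamV 3 (val x3 ◂ (tabA 2 (λ _ → decNonEmpty) ▷ decEmpty ▷ x3 ▷ x1 ▷ x0))

decTmBody : ∀ {n} → Tm (4 + n)
decTmBody = val x1 ◂ (tabA 2 decCase ▷ decEmpty ▷ x3 ▷ x2 ▷ x0)

decTm : ∀ {n} → Val n
decTm = lamV 3 decTmBody

decCost : List Bit → List Bit → ℕ
decCost acc []           = 10 + revCost acc
decCost acc (b0 ∷ r)     = 17 + decCost (b1 ∷ acc) r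
decCost acc (b1 ∷ [])    = 17 + revCost acc
decCost acc (b1 ∷ c ∷ r) = 23 + revCost acc

decTm-reduces : ∀ {n} acc l (K : Val n) →
  val decTm ◂ (ε ▷ decTm ▷ encBits acc ▷ encBits l ▷ K) ⟶⟨ decCost acc l ⟩
  app (val K) (encBits (acc ʳ++ decBin l))
decTm-reduces acc [] K =
  β-lamV 3 decTmBody _
  ⟫ ctx◂ (ε ▷ decTm ▷ encBits acc ▷ K) (encStr-[]-case 2 decCase decEmpty)
  ⟫ β-lamV 2 _ (ε ▷ decTm ▷ encBits acc ▷ K)
  ⟫ revTm-reduces acc [] K
decTm-reduces acc (b0 ∷ r) K =
  β-lamV 3 decTmBody _
  ⟫ ctx◂ (ε ▷ decTm ▷ encBits acc ▷ K) (encStr-∷-case 2 zero (map bitIdx r) decCase decEmpty)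
  ⟫ β-lamV 3 _ (ε ▷ encBits r ▷ decTm ▷ encBits acc ▷ K)
  ⟫ ctx◂ (ε ▷ decTm ▷ encBits r ▷ K) (cons-reduces 2 (suc zero) (map bitIdx acc) recurse)
  ⟫ β-lamV 3 _ (ε ▷ encBits (b1 ∷ acc) ▷ decTm ▷ encBits r ▷ K)
  ⟫ decTm-reduces (b1 ∷ acc) r K
decTm-reduces acc (b1 ∷ []) K =
  β-lamV 3 decTmBody _
  ⟫ ctx◂ (ε ▷ decTm ▷ encBits acc ▷ K) (encStr-∷-case 2 (suc zero) [] decCase decEmpty)
  ⟫ β-lamV 3 _ (ε ▷ encBits [] ▷ decTm ▷ encBits acc ▷ K)
  ⟫ ctx◂ (ε ▷ encBits [] ▷ encBits acc ▷ K) (encStr-[]-case 2 (λ _ → decNonEmpty) decEmpty)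
  ⟫ β-lamV 2 _ (ε ▷ encBits [] ▷ encBits acc ▷ K)
  ⟫ revTm-reduces acc [] K
decTm-reduces acc (b1 ∷ c ∷ r) K =
  β-lamV 3 decTmBody _
  ⟫ ctx◂ (ε ▷ decTm ▷ encBits acc ▷ K) (encStr-∷-case 2 (suc zero) (map bitIdx (c ∷ r)) decCase decEmpty)
  ⟫ β-lamV 3 _ (ε ▷ encBits (c ∷ r) ▷ decTm ▷ encBits acc ▷ K)
  ⟫ ctx◂ (ε ▷ encBits (c ∷ r) ▷ encBits acc ▷ K)
      (encStr-∷-case 2 (bitIdx c) (map bitIdx r) (λ _ → decNonEmpty) decEmpty)
  ⟫ β-lamV 3 _ (ε ▷ encBits r ▷ encBits (c ∷ r) ▷ encBits acc ▷ K)
  ⟫ ctx◂ (ε ▷ encBits acc ▷ K) (cons-reduces 2 zero (map bitIdx (c ∷ r)) revOnto)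
  ⟫ β-lamV 2 _ (ε ▷ encBits (b0 ∷ c ∷ r) ▷ encBits acc ▷ K)
  ⟫ revTm-reduces acc (b0 ∷ c ∷ r) K

data EndsIn1 : List Bit → Set where
  [1] : EndsIn1 (b1 ∷ [])
  _∷_ : ∀ b {l} → EndsIn1 l → EndsIn1 (b ∷ l)

incBin-EndsIn1 : ∀ {l} → EndsIn1 l → EndsIn1 (incBin l)
incBin-EndsIn1 [1]       = b0 ∷ [1]
incBin-EndsIn1 (b0 ∷ p) = b1 ∷ p
incBin-EndsIn1 (b1 ∷ p) = b0 ∷ incBin-EndsIn1 p

bin-suc-EndsIn1 : ∀ k → EndsIn1 (bin (suc k))
bin-suc-EndsIn1 zero    = [1]
bin-suc-EndsIn1 (suc k) = incBin-EndsIn1 (bin-suc-EndsIn1 k)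

decBin-incBin : ∀ {l} → EndsIn1 l → decBin (incBin l) ≡ l
decBin-incBin [1]             = refl
decBin-incBin (b0 ∷ [1])      = refl
decBin-incBin (b0 ∷ (b ∷ p)) = refl
decBin-incBin (b1 ∷ p)        = cong (b1 ∷_) (decBin-incBin p)

decBin-bin-suc : ∀ k → decBin (bin (suc k)) ≡ bin k
decBin-bin-suc zero    = refl
decBin-bin-suc (suc k) = decBin-incBin (bin-suc-EndsIn1 k)

encInput : ∀ {n} → List BI → Val n
encInput l = encStr 4 (map biIdx l)

unreachable : ∀ {n} → Val n
unreachable = lam (val x0)

charCase : ∀ {n} → Fin 4 → Val n
charCase i = lamV 1 (val x0 ◂ (ε ▷ encSym i))

lookupHere : ∀ {n} → Val n
lookupHere = lamV 3 (val x1 ◂ (tabA 4 charCase ▷ unreachable ▷ x0))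

lookupRecurse : ∀ {n} → Val n
lookupRecurse = lamV 3 (val x1 ◂ (ε ▷ x1 ▷ x2 ▷ x3 ▷ x0))

lookupDropHead : ∀ {n} → Val n
lookupDropHead = lamV 3 (val x1 ◂ (tabA 4 (λ _ → lookupRecurse) ▷ unreachable ▷ x3 ▷ x2 ▷ x0))

lookupNext : ∀ {n} → Val n
lookupNext = lamV 4 (val decTm ◂ (ε ▷ decTm ▷ encBits [] ▷ x2 ▷ lookupDropHead ▷ x3 ▷ x1 ▷ x0))

lookupTmBody : ∀ {n} → Tm (4 + n)
lookupTmBody = val x2 ◂ (tabA 2 (λ _ → lookupNext) ▷ lookupHere ▷ x3 ▷ x2 ▷ x1 ▷ x0)

lookupTm : ∀ {n} → Val n
lookupTm = lamV 3 lookupTmBody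

lookupStepCost : List Bit → ℕ
lookupStepCost l = 25 + decCost [] l

lookupTm-step : ∀ {n l} → EndsIn1 l → ∀ x s (K : Val n) →
  val lookupTm ◂ (ε ▷ lookupTm ▷ encBits l ▷ encInput (x ∷ s) ▷ K) ⟶⟨ lookupStepCost l ⟩
  val lookupTm ◂ (ε ▷ lookupTm ▷ encBits (decBin l) ▷ encInput s ▷ K)
lookupTm-step {l = b ∷ r} _ x s K = cast-steps (cong (12 +_) (+-comm (decCost [] (b ∷ r)) 13)) (
  β-lamV 3 lookupTmBody _
  ⟫ ctx◂ (ε ▷ lookupTm ▷ encBits (b ∷ r) ▷ encInput (x ∷ s) ▷ K)
      (encStr-∷-case 2 (bitIdx b) (map bitIdx r) (λ _ → lookupNext) lookupHere)
  ⟫ β-lamV 4 _ (ε ▷ encBits r ▷ lookupTm ▷ encBits (b ∷ r) ▷ encInput (x ∷ s) ▷ K)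
  ⟫ ctx◂ (ε ▷ lookupTm ▷ encInput (x ∷ s) ▷ K) (decTm-reduces [] (b ∷ r) lookupDropHead)
  ⟫ β-lamV 3 _ (ε ▷ encBits (decBin (b ∷ r)) ▷ lookupTm ▷ encInput (x ∷ s) ▷ K)
  ⟫ ctx◂ (ε ▷ encBits (decBin (b ∷ r)) ▷ lookupTm ▷ K)
      (encStr-∷-case 4 (biIdx x) (map biIdx s) (λ _ → lookupRecurse) unreachable)
  ⟫ β-lamV 3 _ (ε ▷ encInput s ▷ encBits (decBin (b ∷ r)) ▷ lookupTm ▷ K))

lookupTm-here : ∀ {n} x s (K : Val n) →
  val lookupTm ◂ (ε ▷ lookupTm ▷ encBits [] ▷ encInput (x ∷ s) ▷ K) ⟶⟨ 18 ⟩ app (val K) (encSym (biIdx x))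
lookupTm-here x s K =
  β-lamV 3 lookupTmBody _
  ⟫ ctx◂ (ε ▷ lookupTm ▷ encBits [] ▷ encInput (x ∷ s) ▷ K) (encStr-[]-case 2 (λ _ → lookupNext) lookupHere)
  ⟫ β-lamV 3 _ (ε ▷ lookupTm ▷ encBits [] ▷ encInput (x ∷ s) ▷ K)
  ⟫ ctx◂ (ε ▷ K) (encStr-∷-case 4 (biIdx x) (map biIdx s) charCase unreachable)
  ⟫ cast-target (cong (app (val K)) (subV-encSym _ (biIdx x))) (β-lamV 1 _ (ε ▷ encInput s ▷ K))

lookupCost : ℕ → ℕ
lookupCost zero    = 18
lookupCost (suc k) = lookupStepCost (bin (suc k)) + lookupCost k

lookupTm-reduces : ∀ {n} k s (k<|s| : k < length s) (K : Val n) →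
  val lookupTm ◂ (ε ▷ lookupTm ▷ encBits (bin k) ▷ encInput s ▷ K) ⟶⟨ lookupCost k ⟩
  app (val K) (encSym (biIdx (lookup s (fromℕ< k<|s|))))
lookupTm-reduces zero    (x ∷ s) _         K = lookupTm-here x s K
lookupTm-reduces (suc k) (x ∷ s) (s≤s k<) K =
  lookupTm-step (bin-suc-EndsIn1 k) x s K
  ⟫ subst (λ l → val lookupTm ◂ (ε ▷ lookupTm ▷ encBits l ▷ encInput s ▷ K) ⟶⟨ lookupCost k ⟩
                  app (val K) (encSym (biIdx (lookup s (fromℕ< k<)))))
      (sym (decBin-bin-suc k)) (lookupTm-reduces k s k< K)

encTape : ∀ {n} → List BW → Val n
encTape l = encStr 3 (map bwIdx l)

encBW : ∀ {n} → BW → Val n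
encBW a = encSym (bwIdx a)

packed : ∀ {n q} → List BI → List Bit → List BW → BW → List BW → Fin q → Val n
packed I B L a R s = lam (val x0 ◂ (ε ▷ encInput I ▷ encBits B ▷ encTape L ▷ encBW a ▷ encTape R ▷ encSym s))

emitTm : ∀ {n} → Val n
emitTm = lamV 7 (val x1 ◂ (ε ▷ x1 ▷ x0 ▷ lam (val x0 ◂ (ε ▷ x8 ▷ x7 ▷ x6 ▷ x5 ▷ x4 ▷ x3))))

emitTm-reduces : ∀ {n q} I B L a R (s : Fin q) (F k : Val n) →
  val emitTm ◂ (ε ▷ encInput I ▷ encBits B ▷ encTape L ▷ encBW a ▷ encTape R ▷ encSym s ▷ F ▷ k) ⟶⟨ 8 ⟩
  val F ◂ (ε ▷ F ▷ k ▷ packed I B L a R s)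
emitTm-reduces I B L a R s F k = cast-target (cong (λ c → val F ◂ (ε ▷ F ▷ k ▷ c)) (cong lam
    (◂-cong₆ (val x0) (renV-encStr suc 4 (map biIdx I)) (renV-encStr suc 2 (map bitIdx B))
       (renV-encStr suc 3 (map bwIdx L)) (renV-encSym suc (bwIdx a)) (renV-encStr suc 3 (map bwIdx R))
       (renV-encSym suc s))))
  (β-lamV 7 _ _)

packed-reduces : ∀ {n q} I B L a R (s : Fin q) (v : Val n) →
  val (packed I B L a R s) ◂ (ε ▷ v) ⟶⟨ 1 ⟩
  val v ◂ (ε ▷ encInput I ▷ encBits B ▷ encTape L ▷ encBW a ▷ encTape R ▷ encSym s)
packed-reduces {n} I B L a R s v = cast-target
  (◂-cong₆ (val v) (subV-encStr σ 4 (map biIdx I)) (subV-encStr σ 2 (map bitIdx B))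
     (subV-encStr σ 3 (map bwIdx L)) (subV-encSym σ (bwIdx a)) (subV-encStr σ 3 (map bwIdx R)) (subV-encSym σ s))
  (β-lamV 0 _ (ε ▷ v))
  where
  σ : Fin (suc n) → Val n
  σ = env (ε ▷ v)

pop : List BW → BW × List BW
pop []      = blank , []
pop (b ∷ l) = b , l

popCons : ∀ {n} → Fin 3 → Val n
popCons i = lamV 1 (val x0 ◂ (ε ▷ encSym i ▷ x1))

popNil : ∀ {n} → Val n
popNil = lam (val x0 ◂ (ε ▷ encBW blank ▷ encTape []))

popTm : ∀ {n} → Val n
popTm = lamV 1 (val x1 ◂ (tabA 3 popCons ▷ popNil ▷ x0))

popCost : List BW → ℕ
popCost []      = 7
popCost (_ ∷ _) = 8

popTm-reduces : ∀ {n} l (K : Val n) →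
  val popTm ◂ (ε ▷ encTape l ▷ K) ⟶⟨ popCost l ⟩ val K ◂ (ε ▷ encBW (proj₁ (pop l)) ▷ encTape (proj₂ (pop l)))
popTm-reduces [] K =
  β-lamV 1 _ (ε ▷ encTape [] ▷ K)
  ⟫ ctx◂ (ε ▷ K) (encStr-[]-case 3 popCons popNil)
  ⟫ β-lamV 0 _ (ε ▷ K)
popTm-reduces (b ∷ l) K =
  β-lamV 1 _ (ε ▷ encTape (b ∷ l) ▷ K)
  ⟫ ctx◂ (ε ▷ K) (encStr-∷-case 3 (bwIdx b) (map bwIdx l) popCons popNil)
  ⟫ cast-target (cong (λ v → val K ◂ (ε ▷ v ▷ encTape l)) (subV-encSym _ (bwIdx b))) (β-lamV 1 _ (ε ▷ encTape l ▷ K))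

pushTm : ∀ {n} → Val n
pushTm = lamV 2 (val x2 ◂ (tabA 3 (cons 3) ▷ x1 ▷ x0))

pushTm-reduces : ∀ {n} a l (K : Val n) →
  val pushTm ◂ (ε ▷ encBW a ▷ encTape l ▷ K) ⟶⟨ 8 ⟩ app (val K) (encTape (a ∷ l))
pushTm-reduces a l K =
  β-lamV 2 _ (ε ▷ encBW a ▷ encTape l ▷ K)
  ⟫ ctx◂ (ε ▷ encTape l ▷ K) (encSym-case 3 (bwIdx a) (cons 3))
  ⟫ cons-reduces 3 (bwIdx a) (map bwIdx l) K

shiftDone : ∀ {n} → Val n
shiftDone = lamV 3 (val x0 ◂ (ε ▷ x2 ▷ x1 ▷ x3))

shiftPush : ∀ {n} → Val n
shiftPush = lamV 4 (val pushTm ◂ (ε ▷ x1 ▷ x2 ▷ shiftDone ▷ x4 ▷ x3 ▷ x0))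

shiftTm : ∀ {n} → Val n
shiftTm = lamV 3 (val popTm ◂ (ε ▷ x3 ▷ shiftPush ▷ x2 ▷ x1 ▷ x0))

shiftCost : List BW → ℕ
shiftCost src = 21 + popCost src

shiftTm-reduces : ∀ {n} src tgt a (K : Val n) →
  val shiftTm ◂ (ε ▷ encTape src ▷ encTape tgt ▷ encBW a ▷ K) ⟶⟨ shiftCost src ⟩
  val K ◂ (ε ▷ encBW (proj₁ (pop src)) ▷ encTape (proj₂ (pop src)) ▷ encTape (a ∷ tgt))
shiftTm-reduces src tgt a K = cast-steps (cong (4 +_) (+-comm (popCost src) 17)) (
  β-lamV 3 _ (ε ▷ encTape src ▷ encTape tgt ▷ encBW a ▷ K)
  ⟫ ctx◂ (ε ▷ encTape tgt ▷ encBW a ▷ K) (popTm-reduces src shiftPush)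
  ⟫ β-lamV 4 _ (ε ▷ encBW b ▷ encTape src' ▷ encTape tgt ▷ encBW a ▷ K)
  ⟫ ctx◂ (ε ▷ encBW b ▷ encTape src' ▷ K) (pushTm-reduces a tgt shiftDone)
  ⟫ β-lamV 3 _ (ε ▷ encTape (a ∷ tgt) ▷ encBW b ▷ encTape src' ▷ K))
  where
  b : BW
  b = proj₁ (pop src)
  src' : List BW
  src' = proj₂ (pop src)

-- The work tape (w_l, a, w_r) is kept with w_l reversed, so that both halves are read from the head outwards.
moveTape : Move → List BW → BW → List BW → List BW × BW × List BW
moveTape down  l a r = l , a , r
moveTape left  l a r = proj₂ (pop l) , proj₁ (pop l) , a ∷ r
moveTape right l a r = a ∷ l , proj₁ (pop r) , proj₂ (pop r)

leftDone : ∀ {n} → Val n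
leftDone = lamV 7 (val emitTm ◂ (ε ▷ x3 ▷ x4 ▷ x6 ▷ x7 ▷ x5 ▷ x2 ▷ x1 ▷ x0))

rightDone : ∀ {n} → Val n
rightDone = lamV 7 (val emitTm ◂ (ε ▷ x3 ▷ x4 ▷ x5 ▷ x7 ▷ x6 ▷ x2 ▷ x1 ▷ x0))

moveTm : ∀ {n} → Move → Val n
moveTm down  = lamV 7 (val emitTm ◂ (ε ▷ x6 ▷ x7 ▷ x5 ▷ x4 ▷ x3 ▷ x2 ▷ x1 ▷ x0))
moveTm left  = lamV 7 (val shiftTm ◂ (ε ▷ x5 ▷ x3 ▷ x4 ▷ leftDone ▷ x7 ▷ x6 ▷ x2 ▷ x1 ▷ x0))
moveTm right = lamV 7 (val shiftTm ◂ (ε ▷ x3 ▷ x5 ▷ x4 ▷ rightDone ▷ x7 ▷ x6 ▷ x2 ▷ x1 ▷ x0))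

moveCost : Move → List BW → List BW → ℕ
moveCost down  l r = 16
moveCost left  l r = 8 + (shiftCost l + 16)
moveCost right l r = 8 + (shiftCost r + 16)

emitted : ∀ {n q} → Val n → Val n → List BI → List Bit → Fin q → List BW × BW × List BW → Tm n
emitted F k I B s (l , a , r) = val F ◂ (ε ▷ F ▷ k ▷ packed I B l a r s)

moveTm-reduces : ∀ {n q} m B I L a R (s : Fin q) (F k : Val n) →
  val (moveTm m) ◂ (ε ▷ encBits B ▷ encInput I ▷ encTape L ▷ encBW a ▷ encTape R ▷ encSym s ▷ F ▷ k)
    ⟶⟨ moveCost m L R ⟩ emitted F k I B s (moveTape m L a R)
moveTm-reduces down B I L a R s F k =
  β-lamV 7 _ _ ⟫ emitTm-reduces I B L a R s F k
moveTm-reduces left B I L a R s F k =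
  β-lamV 7 _ _
  ⟫ ctx◂ (ε ▷ encBits B ▷ encInput I ▷ encSym s ▷ F ▷ k) (shiftTm-reduces L R a leftDone)
  ⟫ β-lamV 7 _ _
  ⟫ emitTm-reduces I B (proj₂ (pop L)) (proj₁ (pop L)) (a ∷ R) s F k
moveTm-reduces right B I L a R s F k =
  β-lamV 7 _ _
  ⟫ ctx◂ (ε ▷ encBits B ▷ encInput I ▷ encSym s ▷ F ▷ k) (shiftTm-reduces R L a rightDone)
  ⟫ β-lamV 7 _ _
  ⟫ emitTm-reduces I B (a ∷ L) (proj₁ (pop R)) (proj₂ (pop R)) s F k

moveHead : Dir → List Bit → List Bit
moveHead stay  B = B
moveHead plus  B = incBin B
moveHead minus B = decBin B

headTm : ∀ {n} → Dir → Val n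
headTm stay  = lamV 1 (val x0 ◂ (ε ▷ x1))
headTm plus  = lamV 1 (val incTm ◂ (ε ▷ incTm ▷ encBits [] ▷ x1 ▷ x0))
headTm minus = lamV 1 (val decTm ◂ (ε ▷ decTm ▷ encBits [] ▷ x1 ▷ x0))

headCost : Dir → List Bit → ℕ
headCost stay  B = 2
headCost plus  B = 2 + incCost [] B
headCost minus B = 2 + decCost [] B

headTm-reduces : ∀ {n} d B (K : Val n) →
  val (headTm d) ◂ (ε ▷ encBits B ▷ K) ⟶⟨ headCost d B ⟩ app (val K) (encBits (moveHead d B))
headTm-reduces stay  B K = β-lamV 1 _ _
headTm-reduces plus  B K = β-lamV 1 _ _ ⟫ incTm-reduces [] B K
headTm-reduces minus B K = β-lamV 1 _ _ ⟫ decTm-reduces [] B K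

headTm-closed : ∀ d → Closed (headTm d)
headTm-closed stay  σ = refl
headTm-closed plus  σ = refl
headTm-closed minus σ = refl

moveTm-closed : ∀ m → Closed (moveTm m)
moveTm-closed down  σ = refl
moveTm-closed left  σ = refl
moveTm-closed right σ = refl

-- Leaves of the transition table receive ⌈i⌉, ⌈bin n⌉, ⌈w_l^R⌉, ⌈w_r⌉, then stepTm, k and ⌈C⌉.
transitionBody : ∀ {n q} → Dir → BW → Move → Fin q → Tm (7 + n)
transitionBody d a m s = val (headTm d) ◂ (ε ▷ x5 ▷ moveTm m ▷ x6 ▷ x4 ▷ encBW a ▷ x3 ▷ encSym s ▷ x2 ▷ x1)

transitionLeaf : ∀ {n q} → Dir → BW → Move → Fin q → Val n
transitionLeaf d a m s = lamV 6 (transitionBody d a m s)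

transitionLeaf-closed : ∀ {q} d a m (s : Fin q) → Closed (transitionLeaf d a m s)
transitionLeaf-closed d a m s {k} {k'} σ = trans (subV-lamV 6 σ (transitionBody d a m s)) (cong (lamV 6)
  (body (headTm-closed d σ') (moveTm-closed m σ') (subV-encSym σ' (bwIdx a)) (subV-encSym σ' s)))
  where
  σ' : Fin (7 + k) → Val (7 + k')
  σ' = extsN 7 σ
  body : ∀ {h h' mv mv' av av' sv sv' : Val (7 + k')} → h ≡ h' → mv ≡ mv' → av ≡ av' → sv ≡ sv' →
         val h ◂ (ε ▷ x5 ▷ mv ▷ x6 ▷ x4 ▷ av ▷ x3 ▷ sv ▷ x2 ▷ x1) ≡
         val h' ◂ (ε ▷ x5 ▷ mv' ▷ x6 ▷ x4 ▷ av' ▷ x3 ▷ sv' ▷ x2 ▷ x1)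
  body refl refl refl refl = refl

transitionLeaf-reduces : ∀ {n q} d a m (s : Fin q) I B L R (F k c : Val n) →
  val (transitionLeaf d a m s) ◂ (ε ▷ encInput I ▷ encBits B ▷ encTape L ▷ encTape R ▷ F ▷ k ▷ c)
    ⟶⟨ 7 + (headCost d B + moveCost m L R) ⟩ emitted F k I (moveHead d B) s (moveTape m L a R)
transitionLeaf-reduces {n} d a m s I B L R F k c =
  cast-target (args (headTm-closed d σ) (moveTm-closed m σ) (subV-encSym σ (bwIdx a)) (subV-encSym σ s)) (β-lamV 6 _ _)
  ⟫ ctx◂ (ε ▷ encInput I ▷ encTape L ▷ encBW a ▷ encTape R ▷ encSym s ▷ F ▷ k) (headTm-reduces d B (moveTm m))
  ⟫ moveTm-reduces m (moveHead d B) I L a R s F k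
  where
  σ : Fin (7 + n) → Val n
  σ = env (ε ▷ encInput I ▷ encBits B ▷ encTape L ▷ encTape R ▷ F ▷ k ▷ c)
  args : ∀ {h h' mv mv' av av' sv sv' : Val n} → h ≡ h' → mv ≡ mv' → av ≡ av' → sv ≡ sv' →
         val h ◂ (ε ▷ encBits B ▷ mv ▷ encInput I ▷ encTape L ▷ av ▷ encTape R ▷ sv ▷ F ▷ k) ≡
         val h' ◂ (ε ▷ encBits B ▷ mv' ▷ encInput I ▷ encTape L ▷ av' ▷ encTape R ▷ sv' ▷ F ▷ k)
  args refl refl refl refl = refl

haltLeaf : ∀ {n} → Val n
haltLeaf = lamV 6 (app (val x1) x0)

ω : ∀ {n} → Val n
ω = lam (app (val x0) x0)

ω-loops : ∀ {n} j → app (val (ω {n})) ω ⟶⟨ j ⟩ app (val ω) ω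
ω-loops zero    = done
ω-loops (suc j) = more β (ω-loops j)

loopLeaf : ∀ {n} → Val n
loopLeaf = lamV 6 (app (val ω) ω)

switch : ∀ {n} m → (Fin m → ∀ {k} → Val k) → Val n
switch m f = lam (val x0 ◂ tabA m (λ i → f i))

subT-switchBody : ∀ {n n'} m (f : Fin m → ∀ {k} → Val k) → (∀ i → Closed (f i)) → (σ : Fin (suc n) → Val n') →
                  subT σ (val x0 ◂ tabA m (λ i → f i)) ≡ val (σ zero) ◂ tabA m (λ i → f i)
subT-switchBody m f f-closed σ = trans (subT-◂ σ (val x0) (tabA m (λ i → f i)))
  (cong (val (σ zero) ◂_) (trans (mapA-tabA m (subV σ) (λ i → f i)) (tabA-cong m (λ i → f-closed i σ))))

switch-closed : ∀ m (f : Fin m → ∀ {k} → Val k) → (∀ i → Closed (f i)) → Closed (switch m f)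
switch-closed m f f-closed σ = cong lam (subT-switchBody m f f-closed (exts σ))

switch-reduces : ∀ {n} m (f : Fin m → ∀ {k} → Val k) → (∀ i → Closed (f i)) → (j : Fin m) →
                 val (switch {n} m f) ◂ (ε ▷ encSym j) ⟶⟨ suc m ⟩ val (f j)
switch-reduces m f f-closed j =
  cast-target (subT-switchBody m f f-closed _) (β-lamV 0 _ (ε ▷ encSym j)) ⟫ encSym-case m j (λ i → f i)

toBI : Fin 4 → BI
toBI zero                = i0
toBI (suc zero)          = i1
toBI (suc (suc zero))    = iL
toBI (suc (suc (suc _))) = iR

toBI-biIdx : ∀ x → toBI (biIdx x) ≡ x
toBI-biIdx i0 = refl
toBI-biIdx i1 = refl
toBI-biIdx iL = refl
toBI-biIdx iR = refl

toBW : Fin 3 → BW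
toBW zero          = w0
toBW (suc zero)    = w1
toBW (suc (suc _)) = blank

toBW-bwIdx : ∀ x → toBW (bwIdx x) ≡ x
toBW-bwIdx w0    = refl
toBW-bwIdx w1    = refl
toBW-bwIdx blank = refl

dispatchTm : ∀ {n} → Val n
dispatchTm = lamV 10 (val x3 ◂ (ε ▷ x10 ▷ x6 ▷ x4 ▷ x9 ▷ x8 ▷ x7 ▷ x5 ▷ x2 ▷ x1 ▷ x0))

unpackTm : ∀ {n} → Val n
unpackTm = lamV 9 (val lookupTm ◂ (ε ▷ lookupTm ▷ x8 ▷ x9 ▷ dispatchTm ▷ x9 ▷ x8 ▷ x7 ▷ x6 ▷ x5 ▷ x4 ▷ x3 ▷ x2 ▷ x1 ▷ x0))

value : List Bit → ℕ
value []       = 0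
value (b0 ∷ l) = 2 * value l
value (b1 ∷ l) = suc (2 * value l)

value-incBin : ∀ l → value (incBin l) ≡ suc (value l)
value-incBin []       = refl
value-incBin (b0 ∷ l) = refl
value-incBin (b1 ∷ l) = trans (cong (2 *_) (value-incBin l)) (*-suc 2 (value l))

value-bin : ∀ k → value (bin k) ≡ k
value-bin zero    = refl
value-bin (suc k) = trans (value-incBin (bin k)) (cong suc (value-bin k))

2^length≤2*value : ∀ {l} → EndsIn1 l → 2 ^ length l ≤ 2 * value l
2^length≤2*value [1]           = ≤-refl
2^length≤2*value {b ∷ l} (b ∷ p) = ≤-trans (*-monoʳ-≤ 2 (2^length≤2*value p)) (*-monoʳ-≤ 2 (head b))
  where
  head : ∀ b → 2 * value l ≤ value (b ∷ l)
  head b0 = ≤-refl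
  head b1 = n≤1+n _

bin-length : ∀ {k N} → k < N → length (bin k) ≤ suc ⌊log₂ N ⌋
bin-length {zero}          k<N = z≤n
bin-length {suc k} {suc N} k<N = begin
  length (bin (suc k))                ≡⟨ sym (⌊log₂[2^n]⌋≡n (length (bin (suc k)))) ⟩
  ⌊log₂ (2 ^ length (bin (suc k))) ⌋ ≤⟨ ⌊log₂⌋-mono-≤ 2^length≤2*sucN ⟩
  ⌊log₂ (2 * suc N) ⌋                 ≡⟨ ⌊log₂[2*b]⌋≡1+⌊log₂b⌋ (suc N) ⟩
  suc ⌊log₂ suc N ⌋                   ∎
  where
  open ≤-Reasoning
  2^length≤2*sucN : 2 ^ length (bin (suc k)) ≤ 2 * suc N
  2^length≤2*sucN = ≤-trans (2^length≤2*value (bin-suc-EndsIn1 k))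
    (*-monoʳ-≤ 2 (≤-trans (≤-reflexive (value-bin (suc k))) (<⇒≤ k<N)))

m+k≡n⇒m≤n : ∀ {m n} k → m + k ≡ n → m ≤ n
m+k≡n⇒m≤n {m} k eq = ≤-trans (m≤m+n m k) (≤-reflexive eq)

-- Each bit is walked over once and, moved to the accumulator, reversed back once.
incCost-linear : ∀ acc l → incCost acc l ≤ 34 * length l + 17 * length acc + 33
incCost-linear acc [] = m+k≡n⇒m≤n 13 (e (length acc))
  where e : ∀ a → 10 + (a * 17 + 10) + 13 ≡ 34 * 0 + 17 * a + 33
        e = solve-∀
incCost-linear acc (b0 ∷ r) = m+k≡n⇒m≤n (34 * length r + 41) (e (length r) (length acc))
  where e : ∀ x a → 16 + (a * 17 + 10) + (34 * x + 41) ≡ 34 * suc x + 17 * a + 33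
        e = solve-∀
incCost-linear acc (b1 ∷ r) = ≤-trans (+-monoʳ-≤ 17 (incCost-linear (b0 ∷ acc) r)) (≤-reflexive (e (length r) (length acc)))
  where e : ∀ x a → 17 + (34 * x + 17 * suc a + 33) ≡ 34 * suc x + 17 * a + 33
        e = solve-∀

decCost-linear : ∀ acc l → decCost acc l ≤ 34 * length l + 17 * length acc + 33
decCost-linear acc [] = m+k≡n⇒m≤n 13 (e (length acc))
  where e : ∀ a → 10 + (a * 17 + 10) + 13 ≡ 34 * 0 + 17 * a + 33
        e = solve-∀
decCost-linear acc (b0 ∷ r) = ≤-trans (+-monoʳ-≤ 17 (decCost-linear (b1 ∷ acc) r)) (≤-reflexive (e (length r) (length acc)))
  where e : ∀ x a → 17 + (34 * x + 17 * suc a + 33) ≡ 34 * suc x + 17 * a + 33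
        e = solve-∀
decCost-linear acc (b1 ∷ []) = m+k≡n⇒m≤n 40 (e (length acc))
  where e : ∀ a → 17 + (a * 17 + 10) + 40 ≡ 34 * 1 + 17 * a + 33
        e = solve-∀
decCost-linear acc (b1 ∷ c ∷ r) = m+k≡n⇒m≤n (34 * length r + 68) (e (length r) (length acc))
  where e : ∀ x a → 23 + (a * 17 + 10) + (34 * x + 68) ≡ 34 * suc (suc x) + 17 * a + 33
        e = solve-∀

shiftCost≤29 : ∀ l → shiftCost l ≤ 29
shiftCost≤29 []      = n≤1+n 28
shiftCost≤29 (_ ∷ _) = ≤-refl

moveCost≤53 : ∀ m l r → moveCost m l r ≤ 53
moveCost≤53 down  l r = m≤m+n 16 37
moveCost≤53 left  l r = +-monoʳ-≤ 8 (+-monoˡ-≤ 16 (shiftCost≤29 l))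
moveCost≤53 right l r = +-monoʳ-≤ 8 (+-monoˡ-≤ 16 (shiftCost≤29 r))

+-mono-≤-sum : ∀ c x y {a b} → a ≤ c * x → b ≤ c * y → a + b ≤ c * (x + y)
+-mono-≤-sum c x y a≤ b≤ = ≤-trans (+-mono-≤ a≤ b≤) (≤-reflexive (sym (*-distribˡ-+ c x y)))

module CostBounds {N : ℕ} (2≤N : 2 ≤ N) where
  open ≤-Reasoning

  L U : ℕ
  L = ⌊log₂ N ⌋
  U = N * L

  1≤L : 1 ≤ L
  1≤L = ⌊log₂⌋-mono-≤ 2≤N

  N≤U : N ≤ U
  N≤U = ≤-trans (≤-reflexive (sym (*-identityʳ N))) (*-monoʳ-≤ N 1≤L)

  L≤U : L ≤ U
  L≤U = ≤-trans (≤-reflexive (sym (*-identityˡ L))) (*-monoˡ-≤ L (≤-trans (n≤1+n 1) 2≤N))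

  1≤U : 1 ≤ U
  1≤U = ≤-trans 1≤L L≤U

  counter-bound : ∀ {k} → k < N → 34 * length (bin k) + 0 + 33 ≤ 67 + 34 * L
  counter-bound {k} k<N = begin
    34 * length (bin k) + 0 + 33 ≤⟨ +-monoˡ-≤ 33 (+-monoˡ-≤ 0 (*-monoʳ-≤ 34 (bin-length k<N))) ⟩
    34 * suc L + 0 + 33          ≡⟨ e L ⟩
    67 + 34 * L                  ∎
    where e : ∀ x → 34 * suc x + 0 + 33 ≡ 67 + 34 * x
          e = solve-∀

  headCost-bound : ∀ d {p} → p < N → headCost d (bin p) ≤ 69 + 34 * L
  headCost-bound stay  p<N = ≤-trans (m≤m+n 2 67) (m≤m+n 69 _)
  headCost-bound plus  {p} p<N = +-monoʳ-≤ 2 (≤-trans (incCost-linear [] (bin p)) (counter-bound p<N))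
  headCost-bound minus {p} p<N = +-monoʳ-≤ 2 (≤-trans (decCost-linear [] (bin p)) (counter-bound p<N))

  lookupCost-bound : ∀ {p} → p < N → lookupCost p ≤ 18 + N * (92 + 34 * L)
  lookupCost-bound {p} p<N = ≤-trans (walk p p<N) (+-monoʳ-≤ 18 (*-monoˡ-≤ (92 + 34 * L) (<⇒≤ p<N)))
    where
    walk : ∀ p → p < N → lookupCost p ≤ 18 + p * (92 + 34 * L)
    walk zero    _   = m≤m+n 18 0
    walk (suc k) k<N = begin
      25 + decCost [] (bin (suc k)) + lookupCost k
        ≤⟨ +-mono-≤ (+-monoʳ-≤ 25 (≤-trans (decCost-linear [] (bin (suc k))) (counter-bound k<N)))
                    (walk k (<⇒≤ k<N)) ⟩
      25 + (67 + 34 * L) + (18 + k * (92 + 34 * L)) ≡⟨ e L k ⟩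
      18 + suc k * (92 + 34 * L)                     ∎
      where e : ∀ x k → 25 + (67 + 34 * x) + (18 + k * (92 + 34 * x)) ≡ 18 + suc k * (92 + 34 * x)
            e = solve-∀

  simulation-bound : ∀ q {X P T} → X ≤ 18 + N * (92 + 34 * L) → P ≤ 69 + 34 * L → T ≤ 53 →
    3 + (1 + (10 + (X + (11 + (5 + (4 + suc q)))))) + (7 + (P + T)) ≤ (342 + q) * U
  simulation-bound q {X} {P} {T} hX hP hT = begin
    3 + (1 + (10 + (X + (11 + (5 + (4 + suc q)))))) + (7 + (P + T))
      ≤⟨ +-mono-≤ (+-monoʳ-≤ 14 (+-monoˡ-≤ (11 + (5 + (4 + suc q))) hX)) (+-monoʳ-≤ 7 (+-mono-≤ hP hT)) ⟩
    3 + (1 + (10 + ((18 + N * (92 + 34 * L)) + (11 + (5 + (4 + suc q)))))) + (7 + ((69 + 34 * L) + 53))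
      ≡⟨ collect q N L ⟩
    (182 + q) * 1 + 92 * N + 34 * U + 34 * L
      ≤⟨ +-mono-≤ (+-monoˡ-≤ (34 * U) (+-mono-≤ (*-monoʳ-≤ (182 + q) 1≤U) (*-monoʳ-≤ 92 N≤U)))
                  (*-monoʳ-≤ 34 L≤U) ⟩
    (182 + q) * U + 92 * U + 34 * U + 34 * U
      ≡⟨ factor q U ⟩
    (342 + q) * U ∎
    where
    collect : ∀ q N L → 3 + (1 + (10 + ((18 + N * (92 + 34 * L)) + (11 + (5 + (4 + suc q))))))
                          + (7 + ((69 + 34 * L) + 53))
                      ≡ (182 + q) * 1 + 92 * N + 34 * (N * L) + 34 * L
    collect = solve-∀
    factor : ∀ q U → (182 + q) * U + 92 * U + 34 * U + 34 * U ≡ (342 + q) * U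
    factor = solve-∀

module Simulation (M : TM) where
  open TM M

  IsFinal : Fin q → Set
  IsFinal s = s ≡ sT ⊎ s ≡ sF

  final? : ∀ s → Dec (IsFinal s)
  final? s = (s ≟ sT) ⊎-dec (s ≟ sF)

  leafFor : ∀ {n} {s : Fin q} → Maybe (Dir × BW × Move × Fin q) → Dec (IsFinal s) → Val n
  leafFor (just (d , a , m , s')) _ = transitionLeaf d a m s'
  leafFor nothing (yes _)           = haltLeaf
  leafFor nothing (no _)            = loopLeaf

  leafFor-closed : ∀ {s : Fin q} r (final : Dec (IsFinal s)) → Closed (leafFor r final)
  leafFor-closed (just (d , a , m , s')) _ = transitionLeaf-closed d a m s'
  leafFor-closed nothing (yes _) σ         = refl
  leafFor-closed nothing (no _) σ          = refl

  leaf : BI → BW → Fin q → ∀ {n} → Val n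
  leaf x a s = leafFor (δ x a s) (final? s)

  δ-final : ∀ x a {s} → IsFinal s → δ x a s ≡ nothing
  δ-final x a (inj₁ refl) = δ-sT x a
  δ-final x a (inj₂ refl) = δ-sF x a

  leaf-final : ∀ {n} x a {s} → IsFinal s → leaf x a s {n} ≡ haltLeaf
  leaf-final x a {s} final rewrite δ-final x a final with final? s
  ... | yes _       = refl
  ... | no notFinal = ⊥-elim (notFinal final)

  leaf-transition : ∀ {n} {x a s d a' m s'} → δ x a s ≡ just (d , a' , m , s') →
                    leaf x a s {n} ≡ transitionLeaf d a' m s'
  leaf-transition eq rewrite eq = refl

  leaf-stuck : ∀ {n} {x a s} → δ x a s ≡ nothing → ¬ IsFinal s → leaf x a s {n} ≡ loopLeaf
  leaf-stuck {s = s} eq notFinal rewrite eq with final? s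
  ... | yes final = ⊥-elim (notFinal final)
  ... | no _      = refl

  stateTable : Fin 4 → Fin 3 → ∀ {n} → Val n
  stateTable i j = switch q (leaf (toBI i) (toBW j))

  symbolTable : Fin 4 → ∀ {n} → Val n
  symbolTable i = switch 3 (stateTable i)

  table : ∀ {n} → Val n
  table = switch 4 symbolTable

  stateTable-closed : ∀ i j → Closed (stateTable i j)
  stateTable-closed i j = switch-closed q _ (λ s → leafFor-closed (δ (toBI i) (toBW j) s) (final? s))

  symbolTable-closed : ∀ i → Closed (symbolTable i)
  symbolTable-closed i = switch-closed 3 _ (stateTable-closed i)

  table-closed : Closed table
  table-closed = switch-closed 4 _ symbolTable-closed

  table-reduces : ∀ {n} x a s →
    val (table {n}) ◂ (ε ▷ encSym (biIdx x) ▷ encBW a ▷ encSym s) ⟶⟨ 5 + (4 + suc q) ⟩ val (leaf x a s)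
  table-reduces x a s =
    ctx◂ (ε ▷ encBW a ▷ encSym s) (switch-reduces 4 symbolTable symbolTable-closed (biIdx x))
    ⟫ ctx◂ (ε ▷ encSym s) (switch-reduces 3 (stateTable (biIdx x)) (stateTable-closed (biIdx x)) (bwIdx a))
    ⟫ cast-target (cong₂ (λ y z → val (leaf y z s)) (toBI-biIdx x) (toBW-bwIdx a))
        (switch-reduces q _ (λ s → leafFor-closed (δ _ _ s) (final? s)) s)

  stepTm : ∀ {n} → Val n
  stepTm = lamV 2 (val x0 ◂ (ε ▷ unpackTm ▷ table ▷ x2 ▷ x1 ▷ x0))

  stepTm-closed : Closed stepTm
  stepTm-closed σ = trans (subV-lamV 2 σ (val x0 ◂ (ε ▷ unpackTm ▷ table ▷ x2 ▷ x1 ▷ x0)))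
    (cong (λ t → lamV 2 (val x0 ◂ (ε ▷ unpackTm ▷ t ▷ x2 ▷ x1 ▷ x0))) (table-closed _))

  run : ∀ {n} → Val n → Val n → Tm n
  run k c = val stepTm ◂ (ε ▷ stepTm ▷ k ▷ c)

  leafArgs : ∀ {n} → Val n → Config q → Args n 7
  leafArgs k C = ε ▷ encInput (inputStr (inp C)) ▷ encBits (bin (pos C)) ▷ encTape (reverse (wl C))
                   ▷ encTape (wr C) ▷ stepTm ▷ k ▷ encConfig M C

  prefixCost : Config q → ℕ
  prefixCost C = 3 + (1 + (10 + (lookupCost (pos C) + (11 + (5 + (4 + suc q))))))

  run-reaches-leaf : ∀ {n} (k : Val n) C →
    run k (encConfig M C) ⟶⟨ prefixCost C ⟩ val (leaf (scanned C) (Config.sym C) (st C)) ◂ leafArgs k C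
  run-reaches-leaf {n} k C =
    cast-target (cong (λ t → val c ◂ (ε ▷ unpackTm ▷ t ▷ stepTm ▷ k ▷ c)) (table-closed _)) (β-lamV 2 _ (ε ▷ stepTm ▷ k ▷ c))
    ⟫ ctx◂ (ε ▷ table ▷ stepTm ▷ k ▷ c) (packed-reduces I B L a R (st C) unpackTm)
    ⟫ β-lamV 9 _ _
    ⟫ ctx◂ (ε ▷ encInput I ▷ encBits B ▷ encTape L ▷ encBW a ▷ encTape R ▷ encSym (st C) ▷ table ▷ stepTm ▷ k ▷ c)
        (lookupTm-reduces (pos C) I (pos< C) dispatchTm)
    ⟫ β-lamV 10 _ _
    ⟫ ctx◂ (leafArgs k C) (table-reduces (scanned C) a (st C))
    where
    c : Val n
    c = encConfig M C
    I : List BI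
    I = inputStr (inp C)
    B : List Bit
    B = bin (pos C)
    L R : List BW
    L = reverse (wl C)
    R = wr C
    a : BW
    a = Config.sym C

  run-final : ∀ {n} (k : Val n) C → Final M C → run k (encConfig M C) ⟶⟨ prefixCost C + 7 ⟩ app (val k) (encConfig M C)
  run-final k C final = run-reaches-leaf k C
    ⟫ cast-source (cong (λ l → val l ◂ leafArgs k C) (leaf-final (scanned C) (Config.sym C) final)) (β-lamV 6 _ (leafArgs k C))

  run-stuck : ∀ {n} (k : Val n) C → δ (scanned C) (Config.sym C) (st C) ≡ nothing → ¬ Final M C →
              run k (encConfig M C) ⟶⟨ prefixCost C + 7 ⟩ app (val ω) ω
  run-stuck k C eq notFinal = run-reaches-leaf k C
    ⟫ cast-source (cong (λ l → val l ◂ leafArgs k C) (leaf-stuck eq notFinal)) (β-lamV 6 _ (leafArgs k C))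

  transitionCost : Config q → Dir → Move → ℕ
  transitionCost C d m = prefixCost C + (7 + (headCost d (bin (pos C)) + moveCost m (reverse (wl C)) (wr C)))

  run-transition : ∀ {n} (k : Val n) C {d a' m s'} → δ (scanned C) (Config.sym C) (st C) ≡ just (d , a' , m , s') →
    run k (encConfig M C) ⟶⟨ transitionCost C d m ⟩
    emitted stepTm k (inputStr (inp C)) (moveHead d (bin (pos C))) s' (moveTape m (reverse (wl C)) a' (wr C))
  run-transition k C {d} {a'} {m} {s'} eq = run-reaches-leaf k C
    ⟫ cast-source (cong (λ l → val l ◂ leafArgs k C) (leaf-transition eq))
        (transitionLeaf-reduces d a' m s' (inputStr (inp C)) (bin (pos C)) (reverse (wl C)) (wr C) stepTm k _)

  moveHead-bin : ∀ {d p p'} → HeadMove d p p' → moveHead d (bin p) ≡ bin p'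
  moveHead-bin (mvMinus {p}) = decBin-bin-suc p
  moveHead-bin mvPlus        = refl
  moveHead-bin mvStay        = refl

  reverseLeft : List BW × BW × List BW → List BW × BW × List BW
  reverseLeft (l , b , r) = reverse l , b , r

  moveTape-workMove : ∀ m wl a wr → moveTape m (reverse wl) a wr ≡ reverseLeft (workMove m wl a wr)
  moveTape-workMove down wl a wr = refl
  moveTape-workMove left wl a wr with reverse wl
  ... | []     = refl
  ... | b ∷ rw = cong (λ l → l , b , a ∷ wr) (sym (reverse-involutive rw))
  moveTape-workMove right wl a []      = cong (λ l → l , blank , []) (sym (reverse-++ wl [ a ]))
  moveTape-workMove right wl a (b ∷ w) = cong (λ l → l , b , w) (sym (reverse-++ wl [ a ]))

  emitted-successor : ∀ {n} (k : Val n) {C D : Config q} {d a' m s'} → inp D ≡ inp C → HeadMove d (pos C) (pos D) →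
    (wl D , Config.sym D , wr D) ≡ workMove m (wl C) a' (wr C) → st D ≡ s' →
    emitted stepTm k (inputStr (inp C)) (moveHead d (bin (pos C))) s' (moveTape m (reverse (wl C)) a' (wr C))
      ≡ run k (encConfig M D)
  emitted-successor k {C} {D} {a' = a'} {m = m} inp≡ head tape≡ st≡ =
    emitted-cong (cong inputStr (sym inp≡)) (moveHead-bin head) (sym st≡)
      (trans (moveTape-workMove m (wl C) a' (wr C)) (cong reverseLeft (sym tape≡)))
    where
    emitted-cong : ∀ {I I' B B'} {s s' : Fin q} {t t'} → I ≡ I' → B ≡ B' → s ≡ s' → t ≡ t' →
                   emitted stepTm k I B s t ≡ emitted stepTm k I' B' s' t'
    emitted-cong refl refl refl refl = refl

  2≤|i| : ∀ u → 2 ≤ length (inputStr u)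
  2≤|i| u = s≤s (subst (1 ≤_) (sym (length-++ (map bitToBI u) {[ iR ]})) (m≤n+m 1 _))

  simulationConstant : ℕ
  simulationConstant = 342 + q

  halt-bound : ∀ C → prefixCost C + 7 ≤ simulationConstant * cost C
  halt-bound C = simulation-bound q (lookupCost-bound (pos< C)) z≤n z≤n
    where open CostBounds (2≤|i| (inp C))

  transition-bound : ∀ C d m → transitionCost C d m ≤ simulationConstant * cost C
  transition-bound C d m =
    simulation-bound q (lookupCost-bound (pos< C)) (headCost-bound d (pos< C)) (moveCost≤53 m _ _)
    where open CostBounds (2≤|i| (inp C))

  stepCost : ∀ {C D} → Step M C D → ℕ
  stepCost {C} (step {d = d} {m = m} _ _ _ _ _) = transitionCost C d m

  stepCost-bound : ∀ {C D} (s : Step M C D) → stepCost s ≤ simulationConstant * cost C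
  stepCost-bound {C} (step {d = d} {m = m} _ _ _ _ _) = transition-bound C d m

  stepCost-positive : ∀ {C D} (s : Step M C D) → 1 ≤ stepCost s
  stepCost-positive (step _ _ _ _ _) = s≤s z≤n

  run-step : ∀ {n} (k : Val n) {C D} (s : Step M C D) → run k (encConfig M C) ⟶⟨ stepCost s ⟩ run k (encConfig M D)
  run-step k {C} {D} (step {d} {a'} {m} {s'} eq inp≡ head tape≡ st≡) =
    cast-target (emitted-successor k {C} {D} {d} {a'} {m} {s'} inp≡ head tape≡ st≡) (run-transition k C eq)

  cost-step : ∀ {C D} → Step M C D → cost D ≡ cost C
  cost-step (step _ inp≡ _ _ _) = cong (λ u → length (inputStr u) * ⌊log₂ length (inputStr u) ⌋) inp≡

  run-steps : ∀ {n} (k : Val n) {C D j} → Steps M C j D → Final M D →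
    Σ ℕ λ m → (m ≤ simulationConstant * (suc j * cost C)) × (run k (encConfig M C) ⟶⟨ m ⟩ app (val k) (encConfig M D))
  run-steps k {C} here final =
    _ , subst (λ x → prefixCost C + 7 ≤ simulationConstant * x) (sym (+-identityʳ (cost C))) (halt-bound C) , run-final k C final
  run-steps k {C} {D} {suc j} (there {C' = C'} s steps) final = extend (run-steps k steps final)
    where
    extend : Σ ℕ (λ m → (m ≤ simulationConstant * (suc j * cost C')) × (run k (encConfig M C') ⟶⟨ m ⟩ app (val k) (encConfig M D))) →
             Σ ℕ λ m → (m ≤ simulationConstant * (suc (suc j) * cost C)) × (run k (encConfig M C) ⟶⟨ m ⟩ app (val k) (encConfig M D))
    extend (m , bound , r) =
      stepCost s + m ,
      +-mono-≤-sum simulationConstant (cost C) (suc j * cost C) (stepCost-bound s) (subst (λ x → m ≤ simulationConstant * (suc j * x)) (cost-step s) bound) ,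
      (run-step k s ⟫ r)

  lookup-last : ∀ {A : Set} (xs : List A) y {p} (p< : p < length (xs ++ [ y ])) → suc p ≡ length (xs ++ [ y ]) →
                lookup (xs ++ [ y ]) (fromℕ< p<) ≡ y
  lookup-last []            y {zero}  _         _  = refl
  lookup-last (x ∷ [])      y {zero}  _         ()
  lookup-last (x ∷ x' ∷ xs) y {zero}  _         ()
  lookup-last (x ∷ xs)      y {suc p} (s≤s p<) eq = lookup-last xs y p< (suc-injective eq)

  headMove-exists : ∀ u {p} (p< : p < length (inputStr u)) {d a s a' m s'} →
    δ (lookup (inputStr u) (fromℕ< p<)) a s ≡ just (d , a' , m , s') →
    Σ ℕ λ p' → HeadMove d p p' × p' < length (inputStr u)
  headMove-exists u {p}     p< {stay}  eq = p , mvStay , p<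
  headMove-exists u {zero}  p< {minus} eq = ⊥-elim (δ-L _ _ minus _ _ _ eq refl)
  headMove-exists u {suc p} p< {minus} eq = p , mvMinus , <-trans (n<1+n p) p<
  headMove-exists u {p}     p< {plus}  eq with m≤n⇒m<n∨m≡n p<
  ... | inj₁ p+1< = suc p , mvPlus , p+1<
  ... | inj₂ last = ⊥-elim (δ-R _ _ plus _ _ _
          (subst (λ x → δ x _ _ ≡ _) (lookup-last (iL ∷ map bitToBI u) iR p< last) eq) refl)

  successor : ∀ C {d a' m s'} → δ (scanned C) (Config.sym C) (st C) ≡ just (d , a' , m , s') → Σ (Config q) (Step M C)
  successor C {a' = a'} {m} {s'} eq with headMove-exists (inp C) (pos< C) eq
  ... | p' , head , p'< = config (inp C) p' p'< (proj₁ tape) (proj₁ (proj₂ tape)) (proj₂ (proj₂ tape)) s'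
                        , step eq refl head refl refl
    where
    tape : List BW × BW × List BW
    tape = workMove m (wl C) a' (wr C)

  NonHalting : Config q → Set
  NonHalting C = ¬ (Σ (Config q) λ D → ∃ λ j → Steps M C j D × Final M D)

  run-unbounded : ∀ {n} (k : Val n) C → NonHalting C → ∀ j → RunsAtLeast (run k (encConfig M C)) j
  run-unbounded k C nh zero    = 0 , z≤n , _ , done
  run-unbounded k C nh (suc j) = continue (δ (scanned C) (Config.sym C) (st C)) refl
    where
    extend : Σ (Config q) (Step M C) → RunsAtLeast (run k (encConfig M C)) (suc j)
    extend (D , s) =
      let m , j≤m , u , r = run-unbounded k D (λ (E , i , steps , final) → nh (E , suc i , there s steps , final)) j
      in stepCost s + m , +-mono-≤ (stepCost-positive s) j≤m , u , (run-step k s ⟫ r)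
    continue : ∀ r → δ (scanned C) (Config.sym C) (st C) ≡ r → RunsAtLeast (run k (encConfig M C)) (suc j)
    continue nothing  eq = prefixCost C + 7 + suc j , m≤n+m (suc j) (prefixCost C + 7) , _ ,
                           (run-stuck k C eq (λ final → nh (C , 0 , here , final)) ⟫ ω-loops (suc j))
    continue (just _) eq = extend (successor C eq)

  run-diverges : ∀ {n} (k : Val n) C → NonHalting C → Diverges (run k (encConfig M C))
  run-diverges k C nh = unbounded⇒diverges (run-unbounded k C nh)

  weaken-run : ∀ {n} (k c : Val n) → app (app (weaken (app (val stepTm) stepTm)) k) c ≡ run k c
  weaken-run k c = cong (λ v → app (app (app (val v) v) k) c) (trans (renV≡subV _ stepTm) (stepTm-closed _))

mainTheorem8 : (M : TM) → Σ (Tm 0) λ trans → Σ ℕ λ c →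
    (∀ {n} (k : Val n) (C : Config (TM.q M)) → Final M C →
      Σ ℕ λ m → (m ≤ c * cost C) ×
        (app (app (weaken trans) k) (encConfig M C) ⟶⟨ m ⟩ app (val k) (encConfig M C)))
  × (∀ {n} (k : Val n) (C D : Config (TM.q M)) → Step M C D →
      Σ ℕ λ m → (m ≤ c * cost C) ×
        (app (app (weaken trans) k) (encConfig M C) ⟶⟨ m ⟩ app (app (weaken trans) k) (encConfig M D)))
  × (∀ {n} (k : Val n) (C D : Config (TM.q M)) (steps : ℕ) → Steps M C steps D → Final M D →
      Σ ℕ λ m → (m ≤ c * (suc steps * cost C)) ×
        (app (app (weaken trans) k) (encConfig M C) ⟶⟨ m ⟩ app (val k) (encConfig M D)))
  × (∀ {n} (k : Val n) (C : Config (TM.q M)) →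
      ¬ (Σ (Config (TM.q M)) λ D → ∃ λ steps → Steps M C steps D × Final M D) →
      Diverges (app (app (weaken trans) k) (encConfig M C)))
mainTheorem8 M = app (val stepTm) stepTm , simulationConstant ,
    (λ k C final → prefixCost C + 7 , halt-bound C ,
       cast-source (weaken-run k (encConfig M C)) (run-final k C final))
  , (λ k C D s → stepCost s , stepCost-bound s ,
       cast-source (weaken-run k (encConfig M C)) (cast-target (sym (weaken-run k (encConfig M D))) (run-step k s)))
  , (λ k C D j steps final → let m , bound , r = run-steps k steps final in
       m , bound , cast-source (weaken-run k (encConfig M C)) r)
  , (λ k C nonHalting → subst Diverges (sym (weaken-run k (encConfig M C))) (run-diverges k C nonHalting))
  where open Simulation M
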